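{- Consider the Diophantine equation \[ (a-c)^2(b^2+1) = (b-c)^2(a^2+1) \qquad (\star) \] in unknowns $a,b,c$. Call a solution $(a,b,c)$ of $(\star)$ trivial if $|a|=|b|$, and nontrivial otherwise. For each square-free integer $d>1$ such that $x^2-dy^2=-1$ has an integral solution, let $(x,y)=(f_n^{(d)},g_n^{(d)})$ denote the $n$-th smallest positive integral solution of $|x^2-dy^2|=1$ (for $n=1,2,3,\dots$), where positive integral solutions are ordered by their $y$-component ($(a_1,a_2)$ is smaller than $(b_1,b_2)$ if $a_2<b_2$). Then every nontrivial integral solution $(a,b,c)$ of $(\star)$ is, after switching $a$ and $b$ if necessary, of one of the forms \[ (a,b,c) = \pm\left( f_{(2m-1)(2n-1)}^{(d)},\ f_{(2m-1)(2n+1)}^{(d)},\ \frac{g_{(2m-1)\cdot 2n}^{(d)}}{g_{2m-1}^{(d)}}\right) \] for some square-free integer $d>1$ such that $x^2-dy^2=-1$ has an integral solution (the case $d=2$ included) and some integers $m,n>0$, or \[ (a,b,c) = \pm\left(f_{2n-1}^{(2)},\ -f_{2n+1}^{(2)},\ f_{2n}^{(2)}\right) \] for some integer $n>0$. Conversely, every triple $(a,b,c)$ of either of these two forms is an integral solution of $(\star)$.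
   Context: Here $f_n^{(2)}, g_n^{(2)}$ are the sequences for $d=2$ (the $n$-th smallest positive integral solution of $|x^2-2y^2|=1$, ordered by the $y$-component). Equation $(\star)$ arises from requiring that $c$ be the slope of an angle bisector between two lines with slopes $a$ and $b$. -}

module Defs where

open import Data.Nat as ℕ using (ℕ; suc; _∸_)
open import Data.Integer as ℤ using (ℤ; +_; _+_; _-_; _*_; -_; ∣_∣)
open import Data.Product using (_×_; _,_; Σ; ∃-syntax; proj₁; proj₂)
open import Data.Sum using (_⊎_)
open import Data.List using (List; length)
open import Data.List.Relation.Unary.Unique.Propositional using (Unique)
open import Data.List.Membership.Propositional using (_∈_)
open import Data.Nat.Divisibility renaming (_∣_ to _∣ℕ_) using ()
open import Function.Bundles using (_⇔_)
open import Relation.Binary.PropositionalEquality using (_≡_; _≢_)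

Star : ℤ → ℤ → ℤ → Set
Star a b c = (a - c) * (a - c) * (b * b + + 1) ≡ (b - c) * (b - c) * (a * a + + 1)

SquareFree : ℕ → Set
SquareFree d = ∀ (k : ℕ) → (k ℕ.* k) ∣ℕ d → k ≡ 1

NegPellSolvable : ℕ → Set
NegPellSolvable d = ∃[ x ] ∃[ y ] (x * x - + d * (y * y) ≡ - + 1)

Admissible : ℕ → Set
Admissible d = SquareFree d × 1 ℕ.< d × NegPellSolvable d

IsSol : ℕ → ℕ → ℕ → Set
IsSol d x y = 0 ℕ.< x × 0 ℕ.< y ×
  ((+ x * + x - + d * (+ y * + y) ≡ + 1) ⊎ (+ x * + x - + d * (+ y * + y) ≡ - + 1))

-- NthSol d n x y : (x , y) = (f_n^(d) , g_n^(d)), i.e. (x , y) is a positive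
-- solution of |x^2 - d y^2| = 1 and there are exactly n - 1 positive solutions
-- with strictly smaller y-component (n ≥ 1).
NthSol : ℕ → ℕ → ℕ → ℕ → Set
NthSol d n x y = 1 ℕ.≤ n × IsSol d x y ×
  ∃[ L ] (suc (length L) ≡ n × Unique L ×
    (∀ (p : ℕ × ℕ) → p ∈ L ⇔ (IsSol d (proj₁ p) (proj₂ p) × proj₂ p ℕ.< y)))

-- First family: ±( f_{(2m-1)(2n-1)}, f_{(2m-1)(2n+1)}, g_{(2m-1)2n} / g_{2m-1} )
FormA : ℤ → ℤ → ℤ → Set
FormA a b c = ∃[ d ] ∃[ m ] ∃[ n ] (Admissible d × 1 ℕ.≤ m × 1 ℕ.≤ n ×
  ∃[ x₁ ] ∃[ y₁ ] ∃[ x₂ ] ∃[ y₂ ] ∃[ x₃ ] ∃[ y₃ ] ∃[ x₄ ] ∃[ y₄ ]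
   (NthSol d ((2 ℕ.* m ∸ 1) ℕ.* (2 ℕ.* n ∸ 1)) x₁ y₁ ×
    NthSol d ((2 ℕ.* m ∸ 1) ℕ.* (2 ℕ.* n ℕ.+ 1)) x₂ y₂ ×
    NthSol d ((2 ℕ.* m ∸ 1) ℕ.* (2 ℕ.* n)) x₃ y₃ ×
    NthSol d (2 ℕ.* m ∸ 1) x₄ y₄ ×
    ((a ≡ + x₁ × b ≡ + x₂ × c * + y₄ ≡ + y₃) ⊎
     (a ≡ - + x₁ × b ≡ - + x₂ × (- c) * + y₄ ≡ + y₃))))

-- Second family: ±( f_{2n-1}^(2), -f_{2n+1}^(2), f_{2n}^(2) )
FormB : ℤ → ℤ → ℤ → Set
FormB a b c = ∃[ n ] (1 ℕ.≤ n ×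
  ∃[ x₁ ] ∃[ y₁ ] ∃[ x₂ ] ∃[ y₂ ] ∃[ x₃ ] ∃[ y₃ ]
   (NthSol 2 (2 ℕ.* n ∸ 1) x₁ y₁ ×
    NthSol 2 (2 ℕ.* n ℕ.+ 1) x₂ y₂ ×
    NthSol 2 (2 ℕ.* n) x₃ y₃ ×
    ((a ≡ + x₁ × b ≡ - + x₂ × c ≡ + x₃) ⊎
     (a ≡ - + x₁ × b ≡ + x₂ × c ≡ - + x₃))))

Nontrivial : ℤ → ℤ → Set
Nontrivial a b = ∣ a ∣ ≢ ∣ b ∣

-- For a ≠ b, (⋆) reads (a − b)·F = 0 with F = (a + b)(1 − c²) + 2c(ab − 1), and
-- W = (a + b)c − (ab − 1) satisfies W² = (a² + 1)(b² + 1) − (a + b)F. So on a nontrivial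
-- solution (a² + 1)(b² + 1) is a square: a² + 1 = du² and b² + 1 = dv² with d square-free,
-- x² − dy² = −1 is solvable, and by descent every positive solution of |x² − dy²| = 1 is
-- (X k, Y k) with X k + Y k √d = ε^k for the fundamental unit ε, of norm −1. Thus
-- |a| = X P and |b| = X Q with P < Q odd; put Q = P + 2t and S = P + t. Expanding
-- (a + b)c = ab − 1 + W in terms of ε^P and ε^t turns it, for each sign of b and of W and
-- each parity of t, into one linear equation for c: c·Y t = Y S, c·X t = X S, or one forcing
-- Y S ∣ Y t or X S ∣ X t, impossible as t < S. Since Y t ∣ Y s iff t ∣ s, while X t ∣ X s
-- with X t > 1 forces s to be an odd multiple of t, comparing parities of S = P + t and t
-- leaves c·Y t = Y S with t odd and S an even multiple of t (the first family), or c = X S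
-- with X t = 1, i.e. t = 1 and ε = 1 + √2 (the second family). The converse is a polynomial
-- identity modulo the norm equations.

module Submission where

module PellEquation where

  open import Data.Nat as ℕ using (ℕ; zero; suc; z≤n; s≤s; _≤_; _<_; _>_; _∸_; _+_; _*_; _%_; _/_; _≤?_; _≟_)
  open import Data.Nat.Properties
  open import Data.Nat.Divisibility
  open import Data.Nat.DivMod using (m≡m%n+[m/n]*n; m%n<n)
  open import Data.Nat.Induction using (<-rec)
  open import Data.Nat.Tactic.RingSolver using (solve; solve-∀)
  open import Data.Integer as ℤ using (ℤ; +_; -_; 1ℤ; -1ℤ)
  import Data.Integer.Properties as ℤP
  import Data.Integer.Tactic.RingSolver as ℤ-Solver
  open import Data.List using (List; []; _∷_; map; upTo; length)
  open import Data.List.Properties using (length-map; length-upTo)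
  open import Data.List.Membership.Propositional using (_∈_)
  open import Data.List.Membership.Propositional.Properties using (∈-map⁺; ∈-map⁻; ∈-upTo⁺; ∈-upTo⁻)
  open import Data.List.Membership.Propositional.Properties.WithK using (unique∧set⇒bag)
  open import Data.List.Relation.Unary.Unique.Propositional using (Unique)
  import Data.List.Relation.Unary.Unique.Propositional.Properties as Unique
  open import Data.List.Relation.Binary.BagAndSetEquality using (∼bag⇒↭)
  open import Data.List.Relation.Binary.Permutation.Propositional.Properties using (↭-length)
  open import Data.Product using (_×_; _,_; ∃-syntax; proj₁; proj₂)
  open import Data.Sum using (_⊎_; inj₁; inj₂; [_,_]′)
  open import Data.Empty using (⊥; ⊥-elim)
  open import Function.Bundles using (_⇔_; mk⇔; Equivalence)
  open import Relation.Binary.PropositionalEquality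
  open import Relation.Binary.Definitions using (Tri; tri<; tri≈; tri>)
  open import Relation.Nullary using (¬_; Dec; yes; no; contradiction)
  open import Relation.Nullary.Decidable using (_×-dec_; _⊎-dec_)
  open import Relation.Unary using (Decidable)
  open import Defs using (IsSol; NthSol)

  PellPos PellNeg PellSol : ℕ → ℕ → ℕ → Set
  PellPos d x y = x * x ≡ d * (y * y) + 1
  PellNeg d x y = x * x + 1 ≡ d * (y * y)
  PellSol d x y = PellPos d x y ⊎ PellNeg d x y

  pellNorm : ℕ → ℕ → ℕ → ℤ
  pellNorm d x y = + x ℤ.* + x ℤ.- + d ℤ.* (+ y ℤ.* + y)

  i-j≡k⇔i≡k+j : ∀ i j k → (i ℤ.- j ≡ k) ⇔ (i ≡ k ℤ.+ j)
  i-j≡k⇔i≡k+j i j k = mk⇔ (λ { refl → lemma₁ i j }) (λ { refl → lemma₂ k j })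
    where
    lemma₁ : ∀ i j → i ≡ (i ℤ.- j) ℤ.+ j
    lemma₁ = ℤ-Solver.solve-∀
    lemma₂ : ∀ k j → (k ℤ.+ j) ℤ.- j ≡ k
    lemma₂ = ℤ-Solver.solve-∀

  i-j≡k⇔j≡i-k : ∀ i j k → (i ℤ.- j ≡ k) ⇔ (j ≡ i ℤ.- k)
  i-j≡k⇔j≡i-k i j k = mk⇔ (λ { refl → lemma₁ i j }) (λ { refl → lemma₂ i k })
    where
    lemma₁ : ∀ i j → j ≡ i ℤ.- (i ℤ.- j)
    lemma₁ = ℤ-Solver.solve-∀
    lemma₂ : ∀ i k → i ℤ.- (i ℤ.- k) ≡ k
    lemma₂ = ℤ-Solver.solve-∀

  pellNorm≡ : ∀ d x y → pellNorm d x y ≡ + (x * x) ℤ.- + (d * (y * y))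
  pellNorm≡ d x y = sym (cong₂ ℤ._-_ (ℤP.pos-* x x) (trans (ℤP.pos-* d (y * y)) (cong (+ d ℤ.*_) (ℤP.pos-* y y))))

  pellPos⇔ : ∀ d x y → PellPos d x y ⇔ (pellNorm d x y ≡ 1ℤ)
  pellPos⇔ d x y = mk⇔
    (λ e → trans (pellNorm≡ d x y) (from (i-j≡k⇔i≡k+j (+ (x * x)) (+ (d * (y * y))) 1ℤ) (cong +_ (trans e (+-comm _ 1)))))
    (λ e → trans (ℤP.+-injective (to (i-j≡k⇔i≡k+j (+ (x * x)) (+ (d * (y * y))) 1ℤ) (trans (sym (pellNorm≡ d x y)) e))) (+-comm 1 _))
    where open Equivalence

  pellNeg⇔ : ∀ d x y → PellNeg d x y ⇔ (pellNorm d x y ≡ -1ℤ)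
  pellNeg⇔ d x y = mk⇔
    (λ e → trans (pellNorm≡ d x y) (from (i-j≡k⇔j≡i-k (+ (x * x)) (+ (d * (y * y))) -1ℤ) (cong +_ (sym e))))
    (λ e → sym (ℤP.+-injective (to (i-j≡k⇔j≡i-k (+ (x * x)) (+ (d * (y * y))) -1ℤ) (trans (sym (pellNorm≡ d x y)) e))))
    where open Equivalence

  -1^k≡±1 : ∀ k → -1ℤ ℤ.^ k ≡ 1ℤ ⊎ -1ℤ ℤ.^ k ≡ -1ℤ
  -1^k≡±1 zero = inj₁ refl
  -1^k≡±1 (suc k) with -1^k≡±1 k
  ... | inj₁ e = inj₂ (cong (-1ℤ ℤ.*_) e)
  ... | inj₂ e = inj₁ (cong (-1ℤ ℤ.*_) e)

  -1^[i+i]≡1 : ∀ i → -1ℤ ℤ.^ (i + i) ≡ 1ℤ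
  -1^[i+i]≡1 i = begin
    -1ℤ ℤ.^ (i + i)        ≡⟨ cong (λ n → -1ℤ ℤ.^ (i + n)) (+-identityʳ i) ⟨
    -1ℤ ℤ.^ (2 * i)        ≡⟨ ℤP.^-*-assoc -1ℤ 2 i ⟨
    (-1ℤ ℤ.^ 2) ℤ.^ i      ≡⟨ ℤP.^-zeroˡ i ⟩
    1ℤ                     ∎
    where open ≡-Reasoning

  -1^[1+i+i]≡-1 : ∀ i → -1ℤ ℤ.^ suc (i + i) ≡ -1ℤ
  -1^[1+i+i]≡-1 i = cong (-1ℤ ℤ.*_) (-1^[i+i]≡1 i)

  even⊎odd : ∀ k → (∃[ i ] k ≡ i + i) ⊎ (∃[ i ] k ≡ suc (i + i))
  even⊎odd zero = inj₁ (0 , refl)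
  even⊎odd (suc k) with even⊎odd k
  ... | inj₁ (i , refl) = inj₂ (i , refl)
  ... | inj₂ (i , refl) = inj₁ (suc i , cong suc (sym (+-suc i i)))

  1ℤ≢-1ℤ : 1ℤ ≢ -1ℤ
  1ℤ≢-1ℤ ()

  -1^k≡1⇒even : ∀ k → -1ℤ ℤ.^ k ≡ 1ℤ → ∃[ i ] k ≡ i + i
  -1^k≡1⇒even k e with even⊎odd k
  ... | inj₁ even = even
  ... | inj₂ (i , refl) = contradiction (trans (sym e) (-1^[1+i+i]≡-1 i)) 1ℤ≢-1ℤ

  -1^k≡-1⇒odd : ∀ k → -1ℤ ℤ.^ k ≡ -1ℤ → ∃[ i ] k ≡ suc (i + i)
  -1^k≡-1⇒odd k e with even⊎odd k
  ... | inj₂ odd = odd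
  ... | inj₁ (i , refl) = contradiction (trans (sym (-1^[i+i]≡1 i)) e) 1ℤ≢-1ℤ

  -1^k≢-[-1^k] : ∀ k → -1ℤ ℤ.^ k ≢ - (-1ℤ ℤ.^ k)
  -1^k≢-[-1^k] k e with -1^k≡±1 k
  ... | inj₁ h = 1ℤ≢-1ℤ (trans (sym h) (trans e (cong -_ h)))
  ... | inj₂ h = 1ℤ≢-1ℤ (sym (trans (sym h) (trans e (cong -_ h))))

  -1^[k*t]≡[-1^t]^k : ∀ k t → -1ℤ ℤ.^ (k * t) ≡ (-1ℤ ℤ.^ t) ℤ.^ k
  -1^[k*t]≡[-1^t]^k k t = trans (cong (-1ℤ ℤ.^_) (*-comm k t)) (sym (ℤP.^-*-assoc -1ℤ t k))

  +[a*b+c*e]≡ : ∀ a b c e → + (a * b + c * e) ≡ + a ℤ.* + b ℤ.+ + c ℤ.* + e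
  +[a*b+c*e]≡ a b c e = trans (ℤP.pos-+ (a * b) (c * e)) (cong₂ ℤ._+_ (ℤP.pos-* a b) (ℤP.pos-* c e))

  +[a*b+c*e*f]≡ : ∀ a b c e f → + (a * b + c * e * f) ≡ + a ℤ.* + b ℤ.+ + c ℤ.* + e ℤ.* + f
  +[a*b+c*e*f]≡ a b c e f =
    trans (+[a*b+c*e]≡ a b (c * e) f) (cong (λ z → + a ℤ.* + b ℤ.+ z ℤ.* + f) (ℤP.pos-* c e))

  ∣-cancel-adjacent : ∀ {m a b z} → (a ≡ b + 1 ⊎ a + 1 ≡ b) → m ∣ a * z → m ∣ b * z → m ∣ z
  ∣-cancel-adjacent {m} {a} {b} {z} (inj₁ refl) m∣az m∣bz =
    ∣m+n∣m⇒∣n (subst (m ∣_) (trans (*-distribʳ-+ z b 1) (cong (_+_ (b * z)) (*-identityˡ z))) m∣az) m∣bz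
  ∣-cancel-adjacent {m} {a} {b} {z} (inj₂ refl) m∣az m∣bz =
    ∣m+n∣m⇒∣n (subst (m ∣_) (trans (*-distribʳ-+ z a 1) (cong (_+_ (a * z)) (*-identityˡ z))) m∣bz) m∣az

  ∣∧<⇒≡0 : ∀ {m n} → m ∣ n → n < m → n ≡ 0
  ∣∧<⇒≡0 {n = zero} _ _ = refl
  ∣∧<⇒≡0 {n = suc n} m∣n n<m = contradiction m∣n (>⇒∤ n<m)

  private
    X-+-step : ∀ d p q a b c e → p * (a * c + d * b * e) + d * q * (a * e + b * c)
                                ≡ (p * a + d * q * b) * c + d * (q * a + p * b) * e
    X-+-step = solve-∀
    Y-+-step : ∀ d p q a b c e → q * (a * c + d * b * e) + p * (a * e + b * c)
                                ≡ (p * a + d * q * b) * e + (q * a + p * b) * c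
    Y-+-step = solve-∀
    X-+-base : ∀ d a b → a ≡ 1 * a + d * 0 * b
    X-+-base = solve-∀
    Y-+-base : ∀ a b → b ≡ 1 * b + 0 * a
    Y-+-base = solve-∀
    brahmagupta : ∀ D P Q A B →
      (P ℤ.* A ℤ.+ D ℤ.* Q ℤ.* B) ℤ.* (P ℤ.* A ℤ.+ D ℤ.* Q ℤ.* B)
        ℤ.- D ℤ.* ((Q ℤ.* A ℤ.+ P ℤ.* B) ℤ.* (Q ℤ.* A ℤ.+ P ℤ.* B))
      ≡ (P ℤ.* P ℤ.- D ℤ.* (Q ℤ.* Q)) ℤ.* (A ℤ.* A ℤ.- D ℤ.* (B ℤ.* B))
    brahmagupta = ℤ-Solver.solve-∀
    pellNorm-1-0 : ∀ D → + 1 ℤ.* + 1 ℤ.- D ℤ.* (+ 0 ℤ.* + 0) ≡ 1ℤ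
    pellNorm-1-0 = ℤ-Solver.solve-∀

  module PellSequence (d p q : ℕ) where

    -- X k + Y k √d = (p + q √d) ^ k
    X Y : ℕ → ℕ
    X zero = 1
    X (suc k) = p * X k + d * q * Y k
    Y zero = 0
    Y (suc k) = q * X k + p * Y k

    X₁≡p : X 1 ≡ p
    X₁≡p = trans (cong (_+_ (p * 1)) (*-zeroʳ (d * q))) (trans (+-identityʳ (p * 1)) (*-identityʳ p))

    Y₁≡q : Y 1 ≡ q
    Y₁≡q = trans (cong (_+_ (q * 1)) (*-zeroʳ p)) (trans (+-identityʳ (q * 1)) (*-identityʳ q))

    X-+ : ∀ i j → X (i + j) ≡ X i * X j + d * Y i * Y j
    Y-+ : ∀ i j → Y (i + j) ≡ X i * Y j + Y i * X j
    X-+ zero j = X-+-base d (X j) (Y j)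
    X-+ (suc i) j rewrite X-+ i j | Y-+ i j = X-+-step d p q (X i) (Y i) (X j) (Y j)
    Y-+ zero j = Y-+-base (X j) (Y j)
    Y-+ (suc i) j rewrite X-+ i j | Y-+ i j = Y-+-step d p q (X i) (Y i) (X j) (Y j)

    X-+ℤ : ∀ i j → + X (i + j) ≡ + X i ℤ.* + X j ℤ.+ + d ℤ.* + Y i ℤ.* + Y j
    X-+ℤ i j = trans (cong +_ (X-+ i j)) (+[a*b+c*e*f]≡ (X i) (X j) d (Y i) (Y j))

    Y-+ℤ : ∀ i j → + Y (i + j) ≡ + X i ℤ.* + Y j ℤ.+ + Y i ℤ.* + X j
    Y-+ℤ i j = trans (cong +_ (Y-+ i j)) (+[a*b+c*e]≡ (X i) (Y j) (Y i) (X j))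

    pellNorm-XY : ∀ k → pellNorm d (X k) (Y k) ≡ pellNorm d p q ℤ.^ k
    pellNorm-XY zero = pellNorm-1-0 (+ d)
    pellNorm-XY (suc k) = begin
      pellNorm d (X (suc k)) (Y (suc k))
        ≡⟨ cong₂ (λ x y → x ℤ.* x ℤ.- + d ℤ.* (y ℤ.* y))
                 (+[a*b+c*e*f]≡ p (X k) d q (Y k)) (+[a*b+c*e]≡ q (X k) p (Y k)) ⟩
      _ ≡⟨ brahmagupta (+ d) (+ p) (+ q) (+ X k) (+ Y k) ⟩
      pellNorm d p q ℤ.* pellNorm d (X k) (Y k)
        ≡⟨ cong (pellNorm d p q ℤ.*_) (pellNorm-XY k) ⟩
      pellNorm d p q ℤ.^ suc k ∎
      where open ≡-Reasoning

    module Monotone (1≤p : 1 ≤ p) (1≤q : 1 ≤ q) (2≤d : 2 ≤ d) where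

      private
        n≤m*n : ∀ {m} n → 1 ≤ m → n ≤ m * n
        n≤m*n {m} n 1≤m = subst (_≤ m * n) (*-identityˡ n) (*-monoˡ-≤ n 1≤m)

        1≤dq : 1 ≤ d * q
        1≤dq = *-mono-≤ (≤-trans (s≤s z≤n) 2≤d) 1≤q

      1≤X : ∀ k → 1 ≤ X k
      1≤X zero = ≤-refl
      1≤X (suc k) = ≤-trans (≤-trans (1≤X k) (n≤m*n (X k) 1≤p)) (m≤m+n _ _)

      X+Y≤X-suc : ∀ k → X k + Y k ≤ X (suc k)
      X+Y≤X-suc k = +-mono-≤ (n≤m*n (X k) 1≤p) (n≤m*n (Y k) 1≤dq)

      X+Y≤Y-suc : ∀ k → X k + Y k ≤ Y (suc k)
      X+Y≤Y-suc k = +-mono-≤ (n≤m*n (X k) 1≤q) (n≤m*n (Y k) 1≤p)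

      Y<Y-suc : ∀ k → Y k < Y (suc k)
      Y<Y-suc k = <-≤-trans (+-monoˡ-≤ (Y k) (1≤X k)) (X+Y≤Y-suc k)

      Y-strictMono : ∀ {i j} → i < j → Y i < Y j
      Y-strictMono {i} {suc j} (s≤s i≤j) with m≤n⇒m<n∨m≡n i≤j
      ... | inj₁ i<j = <-trans (Y-strictMono i<j) (Y<Y-suc j)
      ... | inj₂ refl = Y<Y-suc j

      Y-mono-≤ : ∀ {i j} → i ≤ j → Y i ≤ Y j
      Y-mono-≤ i≤j with m≤n⇒m<n∨m≡n i≤j
      ... | inj₁ i<j = <⇒≤ (Y-strictMono i<j)
      ... | inj₂ refl = ≤-refl

      Y-injective : ∀ {i j} → Y i ≡ Y j → i ≡ j
      Y-injective {i} {j} e with <-cmp i j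
      ... | tri< i<j _ _ = contradiction e (<⇒≢ (Y-strictMono i<j))
      ... | tri≈ _ i≡j _ = i≡j
      ... | tri> _ _ j<i = contradiction (sym e) (<⇒≢ (Y-strictMono j<i))

      Y-cancel-< : ∀ {i j} → Y i < Y j → i < j
      Y-cancel-< {i} {j} h with <-cmp i j
      ... | tri< i<j _ _ = i<j
      ... | tri≈ _ refl _ = contradiction h (<-irrefl refl)
      ... | tri> _ _ j<i = contradiction h (<⇒≯ (Y-strictMono j<i))

      1≤Y : ∀ {k} → 1 ≤ k → 1 ≤ Y k
      1≤Y {suc k} _ = ≤-<-trans z≤n (Y<Y-suc k)

      Y≡0⇒≡0 : ∀ {k} → Y k ≡ 0 → k ≡ 0
      Y≡0⇒≡0 {zero} _ = refl
      Y≡0⇒≡0 {suc k} e = contradiction e (>⇒≢ (1≤Y {suc k} (s≤s z≤n)))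

      X<X-suc : ∀ {k} → 1 ≤ k → X k < X (suc k)
      X<X-suc {suc k} _ = <-≤-trans (m<m+n (X (suc k)) (1≤Y {suc k} (s≤s z≤n))) (X+Y≤X-suc (suc k))

      X-strictMono : ∀ {i j} → 1 ≤ i → i < j → X i < X j
      X-strictMono {i} {suc j} 1≤i (s≤s i≤j) with m≤n⇒m<n∨m≡n i≤j
      ... | inj₁ i<j = <-trans (X-strictMono 1≤i i<j) (X<X-suc (≤-trans 1≤i (<⇒≤ i<j)))
      ... | inj₂ refl = X<X-suc 1≤i

      X-cancel-< : ∀ {i j} → 1 ≤ i → 1 ≤ j → X i < X j → i < j
      X-cancel-< {i} {j} 1≤i 1≤j h with <-cmp i j
      ... | tri< i<j _ _ = i<j
      ... | tri≈ _ refl _ = contradiction h (<-irrefl refl)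
      ... | tri> _ _ j<i = contradiction h (<⇒≯ (X-strictMono 1≤j j<i))

      1<X : ∀ {k} → 2 ≤ k → 1 < X k
      1<X 2≤k = ≤-<-trans (1≤X 1) (X-strictMono (s≤s z≤n) 2≤k)

      X≡1⇒≡1 : ∀ {k} → 1 ≤ k → X k ≡ 1 → k ≡ 1
      X≡1⇒≡1 {suc zero} _ _ = refl
      X≡1⇒≡1 {suc (suc k)} _ e = contradiction e (>⇒≢ (1<X {suc (suc k)} (s≤s (s≤s z≤n))))

      Y<X : ∀ {j t} → 1 ≤ j → j < t → Y j < X t
      Y<X {suc j} {suc t} _ (s≤s j≤t) = <-≤-trans Yj<dqYt (m≤n+m _ _)
        where
        Yj≤Yt : Y (suc j) ≤ Y t
        Yj≤Yt = Y-mono-≤ j≤t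
        Yt+Yt≤dqYt : Y t + Y t ≤ d * q * Y t
        Yt+Yt≤dqYt = subst (_≤ d * q * Y t) (cong (_+_ (Y t)) (+-identityʳ (Y t)))
                           (*-monoˡ-≤ (Y t) (*-mono-≤ 2≤d 1≤q))
        Yj<dqYt : Y (suc j) < d * q * Y t
        Yj<dqYt = <-≤-trans (≤-<-trans Yj≤Yt (m<m+n (Y t) (≤-trans (1≤Y {suc j} (s≤s z≤n)) Yj≤Yt))) Yt+Yt≤dqYt

    module Divisibility (1≤p : 1 ≤ p) (1≤q : 1 ≤ q) (2≤d : 2 ≤ d) (negative : pellNorm d p q ≡ -1ℤ) where

      open Monotone 1≤p 1≤q 2≤d public

      pellNorm-XY≡-1^k : ∀ k → pellNorm d (X k) (Y k) ≡ -1ℤ ℤ.^ k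
      pellNorm-XY≡-1^k k = trans (pellNorm-XY k) (cong (ℤ._^ k) negative)

      pellSol-XY : ∀ k → PellSol d (X k) (Y k)
      pellSol-XY k with -1^k≡±1 k
      ... | inj₁ e = inj₁ (Equivalence.from (pellPos⇔ d (X k) (Y k)) (trans (pellNorm-XY≡-1^k k) e))
      ... | inj₂ e = inj₂ (Equivalence.from (pellNeg⇔ d (X k) (Y k)) (trans (pellNorm-XY≡-1^k k) e))

      private
        X-++ : ∀ t m → X (t + (t + m)) ≡ X t * (X (t + m) + d * Y t * Y m) + d * (Y t * Y t) * X m
        X-++ t m = begin
          X (t + (t + m))                                    ≡⟨ X-+ t (t + m) ⟩
          X t * X (t + m) + d * Y t * Y (t + m)              ≡⟨ cong (λ z → X t * X (t + m) + d * Y t * z) (Y-+ t m) ⟩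
          X t * X (t + m) + d * Y t * (X t * Y m + Y t * X m) ≡⟨ lemma (X t) (X (t + m)) (Y t) (Y m) (X m) d ⟩
          X t * (X (t + m) + d * Y t * Y m) + d * (Y t * Y t) * X m ∎
          where
          open ≡-Reasoning
          lemma : ∀ a b c e f d → a * b + d * c * (a * e + c * f) ≡ a * (b + d * c * e) + d * (c * c) * f
          lemma = solve-∀

      Y∣Y[t+m]⇒Y∣Y[m] : ∀ t m → Y t ∣ Y (t + m) → Y t ∣ Y m
      Y∣Y[t+m]⇒Y∣Y[m] t m h = ∣-cancel-adjacent (pellSol-XY t)
        (subst (Y t ∣_) (sym (*-assoc (X t) (X t) (Y m))) (∣n⇒∣m*n (X t) Y∣XY))
        (∣m⇒∣m*n (Y m) (∣n⇒∣m*n d (∣m⇒∣m*n (Y t) ∣-refl)))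
        where
        Y∣XY : Y t ∣ X t * Y m
        Y∣XY = ∣m+n∣m⇒∣n (subst (Y t ∣_) (trans (Y-+ t m) (+-comm (X t * Y m) (Y t * X m))) h)
                         (∣m⇒∣m*n (X m) ∣-refl)

      Y∣Y[m]⇒Y∣Y[t+m] : ∀ t m → Y t ∣ Y m → Y t ∣ Y (t + m)
      Y∣Y[m]⇒Y∣Y[t+m] t m h = subst (Y t ∣_) (sym (Y-+ t m)) (∣m∣n⇒∣m+n (∣n⇒∣m*n (X t) h) (∣m⇒∣m*n (X m) ∣-refl))

      Y∣Y[k*t+m]⇒Y∣Y[m] : ∀ k t m → Y t ∣ Y (k * t + m) → Y t ∣ Y m
      Y∣Y[k*t+m]⇒Y∣Y[m] zero t m h = h
      Y∣Y[k*t+m]⇒Y∣Y[m] (suc k) t m h =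
        Y∣Y[k*t+m]⇒Y∣Y[m] k t m (Y∣Y[t+m]⇒Y∣Y[m] t _ (subst (λ z → Y t ∣ Y z) (+-assoc t (k * t) m) h))

      Y∣Y[k*t] : ∀ k t → Y t ∣ Y (k * t)
      Y∣Y[k*t] zero t = Y t ∣0
      Y∣Y[k*t] (suc k) t = Y∣Y[m]⇒Y∣Y[t+m] t (k * t) (Y∣Y[k*t] k t)

      Y∣Y⇒∣ : ∀ {t s} → 1 ≤ t → Y t ∣ Y s → t ∣ s
      Y∣Y⇒∣ {t@(suc _)} {s} _ h = m%n≡0⇒n∣m s t (Y≡0⇒≡0 (∣∧<⇒≡0 Y∣Yr (Y-strictMono (m%n<n s t))))
        where
        Y∣Yr : Y t ∣ Y (s % t)
        Y∣Yr = Y∣Y[k*t+m]⇒Y∣Y[m] (s / t) t (s % t)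
                 (subst (λ z → Y t ∣ Y z) (trans (m≡m%n+[m/n]*n s t) (+-comm (s % t) _)) h)

      X∣X[t+[t+m]]⇒X∣X[m] : ∀ t m → X t ∣ X (t + (t + m)) → X t ∣ X m
      X∣X[t+[t+m]]⇒X∣X[m] t m h = ∣-cancel-adjacent (pellSol-XY t)
        (∣m⇒∣m*n (X m) (∣m⇒∣m*n (X t) ∣-refl))
        (∣m+n∣m⇒∣n (subst (X t ∣_) (X-++ t m) h) (∣m⇒∣m*n _ ∣-refl))

      X∣X[k*2t+m]⇒X∣X[m] : ∀ k t m → X t ∣ X (k * (t + t) + m) → X t ∣ X m
      X∣X[k*2t+m]⇒X∣X[m] zero t m h = h
      X∣X[k*2t+m]⇒X∣X[m] (suc k) t m h = X∣X[k*2t+m]⇒X∣X[m] k t m (X∣X[t+[t+m]]⇒X∣X[m] t _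
        (subst (λ z → X t ∣ X z) (trans (+-assoc (t + t) (k * (t + t)) m) (+-assoc t t _)) h))

      X∣X[t+m]⇒X∣Y[m] : ∀ t m → X t ∣ X (t + m) → X t ∣ Y m
      X∣X[t+m]⇒X∣Y[m] t m h = ∣-cancel-adjacent (pellSol-XY t)
        (∣m⇒∣m*n (Y m) (∣m⇒∣m*n (X t) ∣-refl))
        (subst (X t ∣_) (lemma d (Y t) (Y m)) (∣n⇒∣m*n (Y t) X∣dYY))
        where
        X∣dYY : X t ∣ d * Y t * Y m
        X∣dYY = ∣m+n∣m⇒∣n (subst (X t ∣_) (X-+ t m) h) (∣m⇒∣m*n _ ∣-refl)
        lemma : ∀ d c e → c * (d * c * e) ≡ d * (c * c) * e
        lemma = solve-∀

      X∣X⇒≡t-mod-2t : ∀ {t s} → 1 ≤ t → 1 < X t → X t ∣ X s → ∃[ k ] s ≡ k * (t + t) + t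
      X∣X⇒≡t-mod-2t {t@(suc _)} {s} _ 1<Xt h = by-cases (<-cmp r t)
        where
        r : ℕ
        r = s % (t + t)
        s≡ : s ≡ s / (t + t) * (t + t) + r
        s≡ = trans (m≡m%n+[m/n]*n s (t + t)) (+-comm r _)
        X∣Xr : X t ∣ X r
        X∣Xr = X∣X[k*2t+m]⇒X∣X[m] (s / (t + t)) t r (subst (λ z → X t ∣ X z) s≡ h)
        Xr<Xt : ∀ {r} → r < t → X r < X t
        Xr<Xt {zero} _ = 1<Xt
        Xr<Xt {suc r} r<t = X-strictMono (s≤s z≤n) r<t
        by-cases : Tri (r < t) (r ≡ t) (r > t) → ∃[ k ] s ≡ k * (t + t) + t
        by-cases (tri≈ _ r≡t _) = s / (t + t) , trans s≡ (cong (_+_ (s / (t + t) * (t + t))) r≡t)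
        by-cases (tri< r<t _ _) = contradiction X∣Xr (>⇒∤ {{ℕ.>-nonZero (1≤X r)}} (Xr<Xt r<t))
        by-cases (tri> _ _ t<r) = contradiction X∣Ym (>⇒∤ {{ℕ.>-nonZero (1≤Y 1≤m)}} (Y<X 1≤m m<t))
          where
          m : ℕ
          m = r ∸ t
          r≡t+m : r ≡ t + m
          r≡t+m = sym (m+[n∸m]≡n (<⇒≤ t<r))
          1≤m : 1 ≤ m
          1≤m = m<n⇒0<n∸m t<r
          m<t : m < t
          m<t = +-cancelˡ-< t m t (subst (_< t + t) r≡t+m (m%n<n s (t + t)))
          X∣Ym : X t ∣ Y m
          X∣Ym = X∣X[t+m]⇒X∣Y[m] t m (subst (λ z → X t ∣ X z) r≡t+m X∣Xr)

  -1^[k*[t+t]+t]≡-1^t : ∀ k t → -1ℤ ℤ.^ (k * (t + t) + t) ≡ -1ℤ ℤ.^ t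
  -1^[k*[t+t]+t]≡-1^t k t = begin
    -1ℤ ℤ.^ (k * (t + t) + t)                   ≡⟨ ℤP.^-distribˡ-+-* -1ℤ (k * (t + t)) t ⟩
    -1ℤ ℤ.^ (k * (t + t)) ℤ.* -1ℤ ℤ.^ t         ≡⟨ cong (ℤ._* -1ℤ ℤ.^ t) (-1^[k*t]≡[-1^t]^k k (t + t)) ⟩
    (-1ℤ ℤ.^ (t + t)) ℤ.^ k ℤ.* -1ℤ ℤ.^ t       ≡⟨ cong (λ z → z ℤ.^ k ℤ.* -1ℤ ℤ.^ t) (-1^[i+i]≡1 t) ⟩
    1ℤ ℤ.^ k ℤ.* -1ℤ ℤ.^ t                      ≡⟨ cong (ℤ._* -1ℤ ℤ.^ t) (ℤP.^-zeroˡ k) ⟩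
    1ℤ ℤ.* -1ℤ ℤ.^ t                            ≡⟨ ℤP.*-identityˡ (-1ℤ ℤ.^ t) ⟩
    -1ℤ ℤ.^ t                                   ∎
    where open ≡-Reasoning

  *-self-strictMono : ∀ {a b} → a < b → a * a < b * b
  *-self-strictMono a<b = *-mono-< a<b a<b

  <-of-squares : ∀ {a c e e′} → a * a + e ≡ c * c + e′ → e′ < e → a < c
  <-of-squares {a} {c} {e} {e′} eq e′<e with <-≤-connex a c
  ... | inj₁ a<c = a<c
  ... | inj₂ c≤a = contradiction (subst (c * c + e′ <_) eq (+-mono-≤-< (*-mono-≤ c≤a c≤a) e′<e)) (<-irrefl refl)

  1≤n*n : ∀ {n} → 1 ≤ n → 1 ≤ n * n
  1≤n*n 1≤n = *-mono-≤ 1≤n 1≤n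

  module DescentBounds (d x y p q : ℕ) where

    open ≡-Reasoning

    py<xq : 1 ≤ y → q < y → PellSol d x y → PellNeg d p q → p * y < x * q
    py<xq 1≤y _ (inj₁ hx) hp = <-of-squares {e = y * y + q * q} {e′ = 0} (begin
      (p * y) * (p * y) + (y * y + q * q) ≡⟨ solve (p ∷ y ∷ q ∷ []) ⟩
      (p * p + 1) * (y * y) + q * q       ≡⟨ cong (λ z → z * (y * y) + q * q) hp ⟩
      d * (q * q) * (y * y) + q * q       ≡⟨ solve (d ∷ q ∷ y ∷ []) ⟩
      (d * (y * y) + 1) * (q * q)         ≡⟨ cong (_* (q * q)) hx ⟨
      (x * x) * (q * q)                   ≡⟨ solve (x ∷ q ∷ []) ⟩
      (x * q) * (x * q) + 0               ∎) (≤-trans (1≤n*n 1≤y) (m≤m+n _ _))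
    py<xq _ q<y (inj₂ hx) hp = <-of-squares {e = y * y} {e′ = q * q} (begin
      (p * y) * (p * y) + y * y ≡⟨ solve (p ∷ y ∷ []) ⟩
      (p * p + 1) * (y * y)     ≡⟨ cong (_* (y * y)) hp ⟩
      d * (q * q) * (y * y)     ≡⟨ solve (d ∷ q ∷ y ∷ []) ⟩
      (d * (y * y)) * (q * q)   ≡⟨ cong (_* (q * q)) hx ⟨
      (x * x + 1) * (q * q)     ≡⟨ solve (x ∷ q ∷ []) ⟩
      (x * q) * (x * q) + q * q ∎) (*-self-strictMono q<y)

    xq<py+y : 1 ≤ p → 1 ≤ q → q < y → PellSol d x y → PellNeg d p q → x * q < p * y + y
    xq<py+y 1≤p _ q<y (inj₁ hx) hp = <-of-squares {e = (p * (y * y) + p * (y * y))} {e′ = q * q} (begin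
      (x * q) * (x * q) + (p * (y * y) + p * (y * y))                      ≡⟨ solve (x ∷ q ∷ p ∷ y ∷ []) ⟩
      (x * x) * (q * q) + (p * (y * y) + p * (y * y))                      ≡⟨ cong (λ z → z * (q * q) + (p * (y * y) + p * (y * y))) hx ⟩
      (d * (y * y) + 1) * (q * q) + (p * (y * y) + p * (y * y))            ≡⟨ solve (d ∷ y ∷ q ∷ p ∷ []) ⟩
      (d * (q * q)) * (y * y) + (p * (y * y) + p * (y * y)) + q * q        ≡⟨ cong (λ z → z * (y * y) + (p * (y * y) + p * (y * y)) + q * q) hp ⟨
      (p * p + 1) * (y * y) + (p * (y * y) + p * (y * y)) + q * q          ≡⟨ solve (p ∷ y ∷ q ∷ []) ⟩
      (p * y + y) * (p * y + y) + q * q             ∎)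
      (<-≤-trans (*-self-strictMono q<y) (≤-trans (subst (_≤ p * (y * y)) (*-identityˡ (y * y)) (*-monoˡ-≤ (y * y) 1≤p)) (m≤m+n _ _)))
    xq<py+y _ 1≤q _ (inj₂ hx) hp = <-of-squares {e = q * q + (p * (y * y) + p * (y * y))} {e′ = 0} (begin
      (x * q) * (x * q) + (q * q + (p * (y * y) + p * (y * y)))            ≡⟨ solve (x ∷ q ∷ p ∷ y ∷ []) ⟩
      (x * x + 1) * (q * q) + (p * (y * y) + p * (y * y))                  ≡⟨ cong (λ z → z * (q * q) + (p * (y * y) + p * (y * y))) hx ⟩
      (d * (y * y)) * (q * q) + (p * (y * y) + p * (y * y))                ≡⟨ solve (d ∷ y ∷ q ∷ p ∷ []) ⟩
      (d * (q * q)) * (y * y) + (p * (y * y) + p * (y * y))                ≡⟨ cong (λ z → z * (y * y) + (p * (y * y) + p * (y * y))) hp ⟨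
      (p * p + 1) * (y * y) + (p * (y * y) + p * (y * y))                  ≡⟨ solve (p ∷ y ∷ []) ⟩
      (p * y + y) * (p * y + y) + 0                 ∎) (≤-trans (1≤n*n 1≤q) (m≤m+n _ _))

    xp<dyq : 1 ≤ x → q < y → PellSol d x y → PellNeg d p q → x * p < d * y * q
    xp<dyq _ q<y (inj₁ hx) hp = <-of-squares {e = x * x} {e′ = d * (q * q)} (begin
      (x * p) * (x * p) + x * x           ≡⟨ solve (x ∷ p ∷ []) ⟩
      (x * x) * (p * p + 1)               ≡⟨ cong ((x * x) *_) hp ⟩
      (x * x) * (d * (q * q))             ≡⟨ cong (_* (d * (q * q))) hx ⟩
      (d * (y * y) + 1) * (d * (q * q))   ≡⟨ solve (d ∷ y ∷ q ∷ []) ⟩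
      (d * y * q) * (d * y * q) + d * (q * q) ∎)
      (subst (d * (q * q) <_) (sym hx) (≤-<-trans (*-monoʳ-≤ d (*-mono-≤ (<⇒≤ q<y) (<⇒≤ q<y))) (m<m+n _ (s≤s z≤n))))
    xp<dyq 1≤x _ (inj₂ hx) hp = <-of-squares {e = x * x + d * (q * q)} {e′ = 0} (begin
      (x * p) * (x * p) + (x * x + d * (q * q)) ≡⟨ solve (x ∷ p ∷ d ∷ q ∷ []) ⟩
      (x * x) * (p * p + 1) + d * (q * q)       ≡⟨ cong (λ z → (x * x) * z + d * (q * q)) hp ⟩
      (x * x) * (d * (q * q)) + d * (q * q)     ≡⟨ solve (x ∷ d ∷ q ∷ []) ⟩
      (x * x + 1) * (d * (q * q))               ≡⟨ cong (_* (d * (q * q))) hx ⟩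
      (d * (y * y)) * (d * (q * q))             ≡⟨ solve (d ∷ y ∷ q ∷ []) ⟩
      (d * y * q) * (d * y * q) + 0             ∎) (≤-trans (1≤n*n 1≤x) (m≤m+n _ _))

    xq<py : 1 ≤ q → PellNeg d x y → PellPos d p q → x * q < p * y
    xq<py 1≤q hx hp = <-of-squares {e = q * q + y * y} {e′ = 0} (begin
      (x * q) * (x * q) + (q * q + y * y) ≡⟨ solve (x ∷ q ∷ y ∷ []) ⟩
      (x * x + 1) * (q * q) + y * y       ≡⟨ cong (λ z → z * (q * q) + y * y) hx ⟩
      d * (y * y) * (q * q) + y * y       ≡⟨ solve (d ∷ y ∷ q ∷ []) ⟩
      (d * (q * q) + 1) * (y * y)         ≡⟨ cong (_* (y * y)) hp ⟨
      (p * p) * (y * y)                   ≡⟨ solve (p ∷ y ∷ []) ⟩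
      (p * y) * (p * y) + 0               ∎) (≤-trans (1≤n*n 1≤q) (m≤m+n _ _))

    py<xq+y : 1 ≤ x → 1 ≤ q → q < y → PellNeg d x y → PellPos d p q → p * y < x * q + y
    py<xq+y 1≤x 1≤q q<y hx hp = <-of-squares {e = (x * q * y + x * q * y)} {e′ = q * q} (begin
      (p * y) * (p * y) + (x * q * y + x * q * y)                       ≡⟨ solve (p ∷ y ∷ x ∷ q ∷ []) ⟩
      (p * p) * (y * y) + (x * q * y + x * q * y)                       ≡⟨ cong (λ z → z * (y * y) + (x * q * y + x * q * y)) hp ⟩
      (d * (q * q) + 1) * (y * y) + (x * q * y + x * q * y)             ≡⟨ solve (d ∷ q ∷ y ∷ x ∷ []) ⟩
      d * (y * y) * (q * q) + (x * q * y + x * q * y) + y * y           ≡⟨ cong (λ z → z * (q * q) + (x * q * y + x * q * y) + y * y) hx ⟨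
      (x * x + 1) * (q * q) + (x * q * y + x * q * y) + y * y           ≡⟨ solve (x ∷ q ∷ y ∷ []) ⟩
      (x * q + y) * (x * q + y) + q * q              ∎)
      (<-≤-trans (*-monoʳ-< q {{ℕ.>-nonZero 1≤q}} q<y)
        (≤-trans (subst (_≤ x * q * y) (cong (_* y) (*-identityˡ q)) (*-monoˡ-≤ y (*-monoˡ-≤ q 1≤x))) (m≤m+n _ _)))

    dyq<xp : 2 ≤ d → q < y → PellNeg d x y → PellPos d p q → d * y * q < x * p
    dyq<xp 2≤d q<y hx hp = <-of-squares {e = x * x} {e′ = d * (q * q)} (begin
      (d * y * q) * (d * y * q) + x * x         ≡⟨ solve (d ∷ y ∷ q ∷ x ∷ []) ⟩
      (d * (y * y)) * (d * (q * q)) + x * x     ≡⟨ cong (λ z → z * (d * (q * q)) + x * x) hx ⟨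
      (x * x + 1) * (d * (q * q)) + x * x       ≡⟨ solve (x ∷ d ∷ q ∷ []) ⟩
      (x * x) * (d * (q * q) + 1) + d * (q * q) ≡⟨ cong (λ z → (x * x) * z + d * (q * q)) hp ⟨
      (x * x) * (p * p) + d * (q * q)           ≡⟨ solve (x ∷ p ∷ d ∷ q ∷ []) ⟩
      (x * p) * (x * p) + d * (q * q)           ∎) dq²<x²
      where
      dq²+2≤x²+1 : d * (q * q) + 2 ≤ x * x + 1
      dq²+2≤x²+1 = ≤-trans (+-monoʳ-≤ (d * (q * q)) 2≤d)
        (≤-trans (≤-reflexive (sym (trans (*-distribˡ-+ d (q * q) 1) (cong (_+_ (d * (q * q))) (*-identityʳ d)))))
        (≤-trans (*-monoʳ-≤ d (subst (_≤ y * y) (+-comm 1 (q * q)) (*-self-strictMono q<y))) (≤-reflexive (sym hx))))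
      dq²<x² : d * (q * q) < x * x
      dq²<x² = +-cancelʳ-≤ 1 _ _ (subst (_≤ x * x + 1) (+-suc (d * (q * q)) 1) dq²+2≤x²+1)

  PositiveSol : ℕ → ℕ → ℕ → Set
  PositiveSol d x y = 1 ≤ x × 1 ≤ y × PellSol d x y

  +[m∸n]≡+m-+n : ∀ {m n} → n ≤ m → + (m ∸ n) ≡ + m ℤ.- + n
  +[m∸n]≡+m-+n {m} {n} n≤m = trans (sym (ℤP.⊖-≥ n≤m)) (sym (ℤP.[+m]-[+n]≡m⊖n m n))

  +[a*b*c]≡ : ∀ a b c → + (a * b * c) ≡ + a ℤ.* + b ℤ.* + c
  +[a*b*c]≡ a b c = trans (ℤP.pos-* (a * b) c) (cong (ℤ._* + c) (ℤP.pos-* a b))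

  m∸n<o : ∀ {m n o} → n ≤ m → m < n + o → m ∸ n < o
  m∸n<o {m} {n} {o} n≤m m<n+o = subst (m ∸ n <_) (m+n∸m≡n n o) (∸-monoˡ-< m<n+o n≤m)

  n*n-injective : ∀ {m n} → m * m ≡ n * n → m ≡ n
  n*n-injective {m} {n} e with <-cmp m n
  ... | tri< m<n _ _ = contradiction e (<⇒≢ (*-self-strictMono m<n))
  ... | tri≈ _ m≡n _ = m≡n
  ... | tri> _ _ n<m = contradiction (sym e) (<⇒≢ (*-self-strictMono n<m))

  n*n+2≢m*m : ∀ n m → n * n + 2 ≢ m * m
  n*n+2≢m*m zero (suc (suc m)) e =
    contradiction (subst (4 ≤_) (sym e) (*-mono-≤ {2} {suc (suc m)} (s≤s (s≤s z≤n)) (s≤s (s≤s z≤n)))) λ { (s≤s (s≤s ())) }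
  n*n+2≢m*m (suc n) m e with <-≤-connex (suc n) m
  ... | inj₂ m≤n = contradiction (subst (_≤ suc n * suc n) (sym e) (*-mono-≤ m≤n m≤n)) (<⇒≱ (m<m+n (suc n * suc n) (s≤s z≤n)))
  ... | inj₁ n<m = contradiction (subst (suc (suc n) * suc (suc n) ≤_) (sym e) (*-mono-≤ n<m n<m)) (<⇒≱ [1+n]²+2<[2+n]²)
    where
    [1+n]²+2<[2+n]² : suc n * suc n + 2 < suc (suc n) * suc (suc n)
    [1+n]²+2<[2+n]² = subst (suc n * suc n + 2 <_) (sym expand) (m<m+n (suc n * suc n + 2) (s≤s z≤n))
      where
      expand : suc (suc n) * suc (suc n) ≡ suc n * suc n + 2 + suc (n + n)
      expand = solve (n ∷ [])

  n*n+1≡m*m⇒n≡0 : ∀ n m → n * n + 1 ≡ m * m → n ≡ 0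
  n*n+1≡m*m⇒n≡0 zero m e = refl
  n*n+1≡m*m⇒n≡0 (suc n) m e = contradiction (≤-reflexive (sym e)) (<⇒≱ (<-≤-trans [1+n]²+1<[2+n]² (*-mono-≤ n<m n<m)))
    where
    n<m : suc n < m
    n<m = <-of-squares {e = 1} {e′ = 0} (trans e (sym (+-identityʳ (m * m)))) (s≤s z≤n)
    [1+n]²+1<[2+n]² : suc n * suc n + 1 < suc (suc n) * suc (suc n)
    [1+n]²+1<[2+n]² = subst (suc n * suc n + 1 <_) (sym expand) (m<m+n _ (s≤s z≤n))
      where
      expand : suc (suc n) * suc (suc n) ≡ suc n * suc n + 1 + suc (suc (n + n))
      expand = solve (n ∷ [])

  private
    conj-product : ∀ D x y p q →
      (x ℤ.* p ℤ.- D ℤ.* y ℤ.* q) ℤ.* (x ℤ.* p ℤ.- D ℤ.* y ℤ.* q)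
        ℤ.- D ℤ.* ((p ℤ.* y ℤ.- x ℤ.* q) ℤ.* (p ℤ.* y ℤ.- x ℤ.* q))
      ≡ (x ℤ.* x ℤ.- D ℤ.* (y ℤ.* y)) ℤ.* (p ℤ.* p ℤ.- D ℤ.* (q ℤ.* q))
    conj-product = ℤ-Solver.solve-∀

    conj-product′ : ∀ D x y p q →
      (D ℤ.* y ℤ.* q ℤ.- x ℤ.* p) ℤ.* (D ℤ.* y ℤ.* q ℤ.- x ℤ.* p)
        ℤ.- D ℤ.* ((x ℤ.* q ℤ.- p ℤ.* y) ℤ.* (x ℤ.* q ℤ.- p ℤ.* y))
      ≡ (x ℤ.* x ℤ.- D ℤ.* (y ℤ.* y)) ℤ.* (p ℤ.* p ℤ.- D ℤ.* (q ℤ.* q))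
    conj-product′ = ℤ-Solver.solve-∀

    times-X : ∀ D x y p q → p ℤ.* (D ℤ.* y ℤ.* q ℤ.- x ℤ.* p) ℤ.+ D ℤ.* q ℤ.* (x ℤ.* q ℤ.- p ℤ.* y)
                            ≡ x ℤ.* (- (p ℤ.* p ℤ.- D ℤ.* (q ℤ.* q)))
    times-X = ℤ-Solver.solve-∀

    times-Y : ∀ D x y p q → q ℤ.* (D ℤ.* y ℤ.* q ℤ.- x ℤ.* p) ℤ.+ p ℤ.* (x ℤ.* q ℤ.- p ℤ.* y)
                            ≡ y ℤ.* (- (p ℤ.* p ℤ.- D ℤ.* (q ℤ.* q)))
    times-Y = ℤ-Solver.solve-∀

  PellNeg⇒1≤y : ∀ {d x y} → PellNeg d x y → 1 ≤ y
  PellNeg⇒1≤y {d} {x} {zero} e = contradiction (trans (+-comm 1 (x * x)) (trans e (*-zeroʳ d))) λ ()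
  PellNeg⇒1≤y {d} {x} {suc y} e = s≤s z≤n

  -- If the least solution p + q √d had norm +1, dividing a negative solution by it would give a
  -- smaller negative solution.
  module _ {d p q : ℕ} (2≤d : 2 ≤ d) (1≤q : 1 ≤ q) (hp : PellPos d p q)
           (minimal : ∀ {x y} → PositiveSol d x y → q ≤ y) where

    positive-minimal⇒no-negative : ∀ y x → 1 ≤ x → PellNeg d x y → ⊥
    positive-minimal⇒no-negative = <-rec (λ y → ∀ x → 1 ≤ x → PellNeg d x y → ⊥) step
      where
      step : ∀ y → (∀ {y′} → y′ < y → ∀ x → 1 ≤ x → PellNeg d x y′ → ⊥) → ∀ x → 1 ≤ x → PellNeg d x y → ⊥
      step y rec x 1≤x hx with m≤n⇒m<n∨m≡n (minimal (1≤x , PellNeg⇒1≤y {d} {x} hx , inj₂ hx))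
      ... | inj₂ q≡y = n*n+2≢m*m x p (trans (sym (+-assoc (x * x) 1 1))
                                       (trans (cong (_+ 1) (subst (PellNeg d x) (sym q≡y) hx)) (sym hp)))
      ... | inj₁ q<y = rec y′<y x′ (m<n⇒0<n∸m dyq<xp′) (Equivalence.from (pellNeg⇔ d x′ y′) (begin
            pellNorm d x′ y′
              ≡⟨ cong₂ (λ a b → a ℤ.* a ℤ.- + d ℤ.* (b ℤ.* b)) +x′ +y′ ⟩
            _ ≡⟨ conj-product (+ d) (+ x) (+ y) (+ p) (+ q) ⟩
            pellNorm d x y ℤ.* pellNorm d p q
              ≡⟨ cong₂ ℤ._*_ (Equivalence.to (pellNeg⇔ d x y) hx) (Equivalence.to (pellPos⇔ d p q) hp) ⟩
            -1ℤ ∎))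
        where
        open ≡-Reasoning
        open DescentBounds d x y p q
        x′ y′ : ℕ
        x′ = x * p ∸ d * y * q
        y′ = p * y ∸ x * q
        xq<py′ : x * q < p * y
        xq<py′ = xq<py 1≤q hx hp
        dyq<xp′ : d * y * q < x * p
        dyq<xp′ = dyq<xp 2≤d q<y hx hp
        y′<y : y′ < y
        y′<y = m∸n<o (<⇒≤ xq<py′) (py<xq+y 1≤x 1≤q q<y hx hp)
        +x′ : + x′ ≡ + x ℤ.* + p ℤ.- + d ℤ.* + y ℤ.* + q
        +x′ = trans (+[m∸n]≡+m-+n (<⇒≤ dyq<xp′)) (cong₂ ℤ._-_ (ℤP.pos-* x p) (+[a*b*c]≡ d y q))
        +y′ : + y′ ≡ + p ℤ.* + y ℤ.- + x ℤ.* + q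
        +y′ = trans (+[m∸n]≡+m-+n (<⇒≤ xq<py′)) (cong₂ ℤ._-_ (ℤP.pos-* p y) (ℤP.pos-* x q))

  record Fundamental (d : ℕ) : Set where
    field
      p q : ℕ
      1≤p : 1 ≤ p
      1≤q : 1 ≤ q
      negative : PellNeg d p q
      minimal : ∀ {x y} → PositiveSol d x y → q ≤ y

  module Completeness {d : ℕ} (2≤d : 2 ≤ d) (F : Fundamental d) where

    open Fundamental F
    open PellSequence d p q

    private
      -N[p,q]≡1 : - pellNorm d p q ≡ 1ℤ
      -N[p,q]≡1 = cong -_ (Equivalence.to (pellNeg⇔ d p q) negative)

    -- x′ + y′ √d = (x + y √d)(q √d − p): division by the fundamental unit, which has norm −1.
    record Descended (x y : ℕ) : Set where
      field
        x′ y′ : ℕ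
        y′<y : y′ < y
        solution : PositiveSol d x′ y′
        +x′ : + x′ ≡ + d ℤ.* + y ℤ.* + q ℤ.- + x ℤ.* + p
        +y′ : + y′ ≡ + x ℤ.* + q ℤ.- + p ℤ.* + y

    descend : ∀ {x y} → PositiveSol d x y → q < y → Descended x y
    descend {x} {y} (1≤x , 1≤y , hx) q<y = record
      { y′<y = m∸n<o (<⇒≤ py<xq′) (xq<py+y 1≤p 1≤q q<y hx negative)
      ; solution = m<n⇒0<n∸m xp<dyq′ , m<n⇒0<n∸m py<xq′ , sol
      ; +x′ = +x′ ; +y′ = +y′ }
      where
      open DescentBounds d x y p q
      py<xq′ : p * y < x * q
      py<xq′ = py<xq 1≤y q<y hx negative
      xp<dyq′ : x * p < d * y * q
      xp<dyq′ = xp<dyq 1≤x q<y hx negative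
      x′ y′ : ℕ
      x′ = d * y * q ∸ x * p
      y′ = x * q ∸ p * y
      +x′ : + x′ ≡ + d ℤ.* + y ℤ.* + q ℤ.- + x ℤ.* + p
      +x′ = trans (+[m∸n]≡+m-+n (<⇒≤ xp<dyq′)) (cong₂ ℤ._-_ (+[a*b*c]≡ d y q) (ℤP.pos-* x p))
      +y′ : + y′ ≡ + x ℤ.* + q ℤ.- + p ℤ.* + y
      +y′ = trans (+[m∸n]≡+m-+n (<⇒≤ py<xq′)) (cong₂ ℤ._-_ (ℤP.pos-* x q) (ℤP.pos-* p y))
      N[x′,y′] : pellNorm d x′ y′ ≡ pellNorm d x y ℤ.* - 1ℤ
      N[x′,y′] = begin
        pellNorm d x′ y′ ≡⟨ cong₂ (λ a b → a ℤ.* a ℤ.- + d ℤ.* (b ℤ.* b)) +x′ +y′ ⟩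
        _                ≡⟨ conj-product′ (+ d) (+ x) (+ y) (+ p) (+ q) ⟩
        pellNorm d x y ℤ.* pellNorm d p q ≡⟨ cong (pellNorm d x y ℤ.*_) (Equivalence.to (pellNeg⇔ d p q) negative) ⟩
        pellNorm d x y ℤ.* - 1ℤ ∎
        where open ≡-Reasoning
      sol : PellSol d x′ y′
      sol = [ (λ h → inj₂ (Equivalence.from (pellNeg⇔ d x′ y′)
                          (trans N[x′,y′] (cong (ℤ._* -1ℤ) (Equivalence.to (pellPos⇔ d x y) h)))))
            , (λ h → inj₁ (Equivalence.from (pellPos⇔ d x′ y′)
                          (trans N[x′,y′] (cong (ℤ._* -1ℤ) (Equivalence.to (pellNeg⇔ d x y) h))))) ]′ hx

    complete : ∀ y x → PositiveSol d x y → ∃[ k ] (1 ≤ k × x ≡ X k × y ≡ Y k)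
    complete = <-rec (λ y → ∀ x → PositiveSol d x y → ∃[ k ] (1 ≤ k × x ≡ X k × y ≡ Y k)) step
      where
      step : ∀ y → (∀ {y′} → y′ < y → ∀ x → PositiveSol d x y′ → ∃[ k ] (1 ≤ k × x ≡ X k × y′ ≡ Y k)) →
             ∀ x → PositiveSol d x y → ∃[ k ] (1 ≤ k × x ≡ X k × y ≡ Y k)
      step y rec x s@(_ , _ , hx) with m≤n⇒m<n∨m≡n (minimal s)
      ... | inj₂ refl with hx
      ...   | inj₁ h = ⊥-elim (n*n+2≢m*m p x (trans (sym (+-assoc (p * p) 1 1)) (trans (cong (_+ 1) negative) (sym h))))
      ...   | inj₂ h = 1 , ≤-refl , trans (n*n-injective (+-cancelʳ-≡ 1 _ _ (trans h (sym negative)))) (sym X₁≡p) , sym Y₁≡q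
      step y rec x s | inj₁ q<y with descend s q<y
      ... | D with rec (Descended.y′<y D) (Descended.x′ D) (Descended.solution D)
      ...   | k , _ , x′≡Xk , y′≡Yk = suc k , s≤s z≤n , ℤP.+-injective +x≡ , ℤP.+-injective +y≡
        where
        open Descended D
        open ≡-Reasoning
        +x≡ : + x ≡ + X (suc k)
        +x≡ = sym (begin
          + X (suc k)                               ≡⟨ +[a*b+c*e*f]≡ p (X k) d q (Y k) ⟩
          + p ℤ.* + X k ℤ.+ + d ℤ.* + q ℤ.* + Y k  ≡⟨ cong₂ (λ a b → + p ℤ.* a ℤ.+ + d ℤ.* + q ℤ.* b)
                                                            (trans (cong +_ (sym x′≡Xk)) +x′) (trans (cong +_ (sym y′≡Yk)) +y′) ⟩
          _                                         ≡⟨ times-X (+ d) (+ x) (+ y) (+ p) (+ q) ⟩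
          + x ℤ.* - pellNorm d p q                  ≡⟨ cong (+ x ℤ.*_) -N[p,q]≡1 ⟩
          + x ℤ.* 1ℤ                                ≡⟨ ℤP.*-identityʳ (+ x) ⟩
          + x                                       ∎)
        +y≡ : + y ≡ + Y (suc k)
        +y≡ = sym (begin
          + Y (suc k)                        ≡⟨ +[a*b+c*e]≡ q (X k) p (Y k) ⟩
          + q ℤ.* + X k ℤ.+ + p ℤ.* + Y k   ≡⟨ cong₂ (λ a b → + q ℤ.* a ℤ.+ + p ℤ.* b)
                                                     (trans (cong +_ (sym x′≡Xk)) +x′) (trans (cong +_ (sym y′≡Yk)) +y′) ⟩
          _                                  ≡⟨ times-Y (+ d) (+ x) (+ y) (+ p) (+ q) ⟩
          + y ℤ.* - pellNorm d p q           ≡⟨ cong (+ y ℤ.*_) -N[p,q]≡1 ⟩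
          + y ℤ.* 1ℤ                         ≡⟨ ℤP.*-identityʳ (+ y) ⟩
          + y                                ∎)

  least-witness : ∀ {P : ℕ → Set} → Decidable P → ∀ n → P n → ∃[ m ] (P m × (∀ {k} → k < m → ¬ P k))
  least-witness {P} P? = <-rec (λ n → P n → ∃[ m ] (P m × (∀ {k} → k < m → ¬ P k))) step
    where
    step : ∀ n → (∀ {m} → m < n → P m → ∃[ m ] (P m × (∀ {k} → k < m → ¬ P k))) →
           P n → ∃[ m ] (P m × (∀ {k} → k < m → ¬ P k))
    step n rec Pn with anyUpTo? P? n
    ... | yes (k , k<n , Pk) = rec k<n Pk
    ... | no none = n , Pn , λ k<n Pk → none (_ , k<n , Pk)

  positiveSol? : ∀ d x y → Dec (PositiveSol d x y)
  positiveSol? d x y = (1 ≤? x) ×-dec (1 ≤? y) ×-dec ((x * x ≟ d * (y * y) + 1) ⊎-dec (x * x + 1 ≟ d * (y * y)))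

  PellSol⇒x≤dy²+1 : ∀ {d x y} → PellSol d x y → x ≤ d * (y * y) + 1
  PellSol⇒x≤dy²+1 {d} {x} {y} h = ≤-trans (m≤m*m x) (x*x≤ h)
    where
    m≤m*m : ∀ m → m ≤ m * m
    m≤m*m zero = z≤n
    m≤m*m (suc m) = m≤m*n (suc m) (suc m)
    x*x≤ : PellSol d x y → x * x ≤ d * (y * y) + 1
    x*x≤ (inj₁ e) = ≤-reflexive e
    x*x≤ (inj₂ e) = ≤-trans (m≤m+n (x * x) 1) (≤-trans (≤-reflexive e) (m≤m+n _ 1))

  PellNeg⇒1≤x : ∀ {d x y} → 2 ≤ d → PellNeg d x y → 1 ≤ x
  PellNeg⇒1≤x {d} {zero} {y} 2≤d e =
    contradiction (≤-trans (m≤m*n d (y * y) {{ℕ.>-nonZero (1≤n*n (PellNeg⇒1≤y {d} {0} {y} e))}}) (≤-reflexive (sym e))) (<⇒≱ 2≤d)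
  PellNeg⇒1≤x {d} {suc x} _ _ = s≤s z≤n

  fundamental : ∀ {d x₀ y₀} → 2 ≤ d → PellNeg d x₀ y₀ → Fundamental d
  fundamental {d} {x₀} {y₀} 2≤d h₀
    with least-witness SolutionAt? y₀ (x₀ , s≤s (PellSol⇒x≤dy²+1 {d} {x₀} {y₀} (inj₂ h₀)) , 1≤x₀ , PellNeg⇒1≤y {d} {x₀} {y₀} h₀ , inj₂ h₀)
    where
    SolutionAt : ℕ → Set
    SolutionAt y = ∃[ x ] (x < suc (d * (y * y) + 1) × PositiveSol d x y)
    SolutionAt? : Decidable SolutionAt
    SolutionAt? y = anyUpTo? (λ x → positiveSol? d x y) (suc (d * (y * y) + 1))
    1≤x₀ : 1 ≤ x₀
    1≤x₀ = PellNeg⇒1≤x {d} {x₀} {y₀} 2≤d h₀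
  ... | q , (p , _ , 1≤p , 1≤q , pq) , below = record
    { p = p ; q = q ; 1≤p = 1≤p ; 1≤q = 1≤q ; negative = negative ; minimal = minimal }
    where
    minimal : ∀ {x y} → PositiveSol d x y → q ≤ y
    minimal {x} {y} s@(_ , _ , h) = ≮⇒≥ λ y<q → below y<q (x , s≤s (PellSol⇒x≤dy²+1 {d} {x} {y} h) , s)
    negative : PellNeg d p q
    negative = [ (λ pos → ⊥-elim (positive-minimal⇒no-negative {d} {p} {q} 2≤d 1≤q pos minimal y₀ x₀ (PellNeg⇒1≤x {d} {x₀} {y₀} 2≤d h₀) h₀))
               , (λ neg → neg) ]′ pq

  module NthSolution {d : ℕ} (2≤d : 2 ≤ d) (F : Fundamental d) where

    open Fundamental F
    open PellSequence d p q public
    open Divisibility 1≤p 1≤q 2≤d (Equivalence.to (pellNeg⇔ d p q) negative) public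
    open Completeness 2≤d F

    IsSol⇒PositiveSol : ∀ {x y} → IsSol d x y → PositiveSol d x y
    IsSol⇒PositiveSol {x} {y} (1≤x , 1≤y , inj₁ e) = 1≤x , 1≤y , inj₁ (Equivalence.from (pellPos⇔ d x y) e)
    IsSol⇒PositiveSol {x} {y} (1≤x , 1≤y , inj₂ e) = 1≤x , 1≤y , inj₂ (Equivalence.from (pellNeg⇔ d x y) e)

    PositiveSol⇒IsSol : ∀ {x y} → PositiveSol d x y → IsSol d x y
    PositiveSol⇒IsSol {x} {y} (1≤x , 1≤y , inj₁ e) = 1≤x , 1≤y , inj₁ (Equivalence.to (pellPos⇔ d x y) e)
    PositiveSol⇒IsSol {x} {y} (1≤x , 1≤y , inj₂ e) = 1≤x , 1≤y , inj₂ (Equivalence.to (pellNeg⇔ d x y) e)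

    IsSol-XY : ∀ {k} → 1 ≤ k → IsSol d (X k) (Y k)
    IsSol-XY {k} 1≤k = PositiveSol⇒IsSol (1≤X k , 1≤Y {k} 1≤k , pellSol-XY k)

    IsSol⇒XY : ∀ {x y} → IsSol d x y → ∃[ k ] (1 ≤ k × x ≡ X k × y ≡ Y k)
    IsSol⇒XY s = complete _ _ (IsSol⇒PositiveSol s)

    private
      XY-suc : ℕ → ℕ × ℕ
      XY-suc k = X (suc k) , Y (suc k)

      first : ℕ → List (ℕ × ℕ)
      first m = map XY-suc (upTo m)

      length-first : ∀ m → length (first m) ≡ m
      length-first m = trans (length-map XY-suc (upTo m)) (length-upTo m)

      unique-first : ∀ m → Unique (first m)
      unique-first m = Unique.map⁺ (λ e → suc-injective (Y-injective (cong proj₂ e))) (Unique.upTo⁺ m)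

      ∈-first⇔ : ∀ m s → s ∈ first m ⇔ (IsSol d (proj₁ s) (proj₂ s) × proj₂ s < Y (suc m))
      ∈-first⇔ m s = mk⇔ to from
        where
        to : s ∈ first m → IsSol d (proj₁ s) (proj₂ s) × proj₂ s < Y (suc m)
        to s∈ with ∈-map⁻ XY-suc s∈
        ... | k , k∈ , refl = IsSol-XY {suc k} (s≤s z≤n) , Y-strictMono (s≤s (∈-upTo⁻ k∈))
        from : IsSol d (proj₁ s) (proj₂ s) × proj₂ s < Y (suc m) → s ∈ first m
        from (sol , y<) with IsSol⇒XY sol
        from ((_ , _) , y<) | suc k , _ , refl , refl = ∈-map⁺ XY-suc (∈-upTo⁺ (ℕ.s≤s⁻¹ (Y-cancel-< {suc k} {suc m} y<)))

    NthSol-XY : ∀ {n} → 1 ≤ n → NthSol d n (X n) (Y n)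
    NthSol-XY {suc m} _ = s≤s z≤n , IsSol-XY {suc m} (s≤s z≤n) , first m , cong suc (length-first m) , unique-first m , ∈-first⇔ m

    NthSol⇒XY : ∀ {n x y} → NthSol d n x y → x ≡ X n × y ≡ Y n
    NthSol⇒XY {n} (_ , sol , L , |L|+1≡n , unique-L , ∈L⇔) with IsSol⇒XY sol
    ... | suc m , _ , refl , refl = cong X n≡ , cong Y n≡
      where
      same-elements : ∀ {s} → s ∈ L ⇔ s ∈ first m
      same-elements {s} = mk⇔ (λ h → Equivalence.from (∈-first⇔ m s) (Equivalence.to (∈L⇔ s) h))
                              (λ h → Equivalence.from (∈L⇔ s) (Equivalence.to (∈-first⇔ m s) h))
      n≡ : suc m ≡ n
      n≡ = trans (cong suc (sym (trans (↭-length (∼bag⇒↭ (unique∧set⇒bag unique-L (unique-first m) same-elements))) (length-first m)))) |L|+1≡n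

module SquareFreeParts where

  open import Data.Nat as ℕ using (ℕ; zero; suc; z≤n; s≤s; _≤_; _<_; _+_; _*_; _≤?_; NonZero)
  open import Data.Nat.Properties
  open import Data.Nat.Divisibility
  open import Data.Nat.GCD using (gcd; gcd[m,n]∣m; gcd[m,n]∣n; gcd-greatest; gcd[m,n]≢0)
  open import Data.Nat.Coprimality as Coprime using (Coprime; coprime-divisor)
  open import Data.Nat.Induction using (<-rec)
  open import Data.Nat.Tactic.RingSolver using (solve; solve-∀)
  open import Data.List using ([]; _∷_)
  open import Data.Product using (_×_; _,_; ∃-syntax)
  open import Data.Sum using (inj₁)
  open import Relation.Binary.PropositionalEquality
  open import Relation.Nullary using (yes; no; contradiction)
  open import Relation.Nullary.Decidable using (_×-dec_)
  open import Defs using (SquareFree)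

  SquareFree⇒≢0 : ∀ {d} → SquareFree d → d ≢ 0
  SquareFree⇒≢0 sf refl with sf 2 (4 ∣0)
  ... | ()

  divide-by-gcd : ∀ m n → 1 ≤ m → ∃[ g ] ∃[ m′ ] ∃[ n′ ] (1 ≤ g × m ≡ m′ * g × n ≡ n′ * g × Coprime m′ n′)
  divide-by-gcd m n 1≤m = g , _∣_.quotient g∣m , _∣_.quotient g∣n , 1≤g , _∣_.equality g∣m , _∣_.equality g∣n , coprime
    where
    g : ℕ
    g = gcd m n
    g∣m : g ∣ m
    g∣m = gcd[m,n]∣m m n
    g∣n : g ∣ n
    g∣n = gcd[m,n]∣n m n
    1≤g : 1 ≤ g
    1≤g = n≢0⇒n>0 (gcd[m,n]≢0 m n (inj₁ (λ e → <⇒≢ 1≤m (sym e))))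
    instance
      _ : NonZero g
      _ = ℕ.>-nonZero 1≤g
    coprime : Coprime (_∣_.quotient g∣m) (_∣_.quotient g∣n)
    coprime {i} (i∣m′ , i∣n′) = ∣1⇒≡1 (*-cancelʳ-∣ g (subst (i * g ∣_) (sym (*-identityˡ g)) ig∣g))
      where
      ig∣g : i * g ∣ g
      ig∣g = gcd-greatest (subst (i * g ∣_) (sym (_∣_.equality g∣m)) (*-monoˡ-∣ g i∣m′))
                          (subst (i * g ∣_) (sym (_∣_.equality g∣n)) (*-monoˡ-∣ g i∣n′))

  coprime-squareʳ : ∀ {a b} → Coprime a b → Coprime a (b * b)
  coprime-squareʳ {a} {b} c {i} (i∣a , i∣bb) = c (i∣a , coprime-divisor coprime-i-b i∣bb)
    where
    coprime-i-b : Coprime i b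
    coprime-i-b (j∣i , j∣b) = c (∣-trans j∣i i∣a , j∣b)

  coprime-squares : ∀ {a b} → Coprime a b → Coprime (a * a) (b * b)
  coprime-squares c = Coprime.sym (coprime-squareʳ (Coprime.sym (coprime-squareʳ c)))

  SquareFree⇒∣square⇒∣ : ∀ {d w} → SquareFree d → d ∣ w * w → d ∣ w
  SquareFree⇒∣square⇒∣ {d} {w} sf d∣ww with divide-by-gcd d w (n≢0⇒n>0 (SquareFree⇒≢0 sf))
  ... | g , d′ , w′ , 1≤g , d≡ , w≡ , coprime = subst (_∣ w) (sym d≡g) (divides w′ w≡)
    where
    instance
      _ : NonZero g
      _ = ℕ.>-nonZero 1≤g
    d′∣w′w′g : d′ ∣ w′ * w′ * g
    d′∣w′w′g = *-cancelʳ-∣ g (subst₂ _∣_ d≡ (trans (cong₂ _*_ w≡ w≡) (solve (w′ ∷ g ∷ []))) d∣ww)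
    d′≡1 : d′ ≡ 1
    d′≡1 = sf d′ (subst (d′ * d′ ∣_) (sym d≡) (*-monoʳ-∣ d′ (coprime-divisor (coprime-squareʳ coprime) d′∣w′w′g)))
    d≡g : d ≡ g
    d≡g = trans d≡ (trans (cong (_* g) d′≡1) (*-identityˡ g))

  squareFree-decomposition : ∀ A → 1 ≤ A → ∃[ d ] ∃[ u ] (SquareFree d × A ≡ d * (u * u))
  squareFree-decomposition = <-rec (λ A → 1 ≤ A → ∃[ d ] ∃[ u ] (SquareFree d × A ≡ d * (u * u))) step
    where
    step : ∀ A → (∀ {A′} → A′ < A → 1 ≤ A′ → ∃[ d ] ∃[ u ] (SquareFree d × A′ ≡ d * (u * u))) →
           1 ≤ A → ∃[ d ] ∃[ u ] (SquareFree d × A ≡ d * (u * u))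
    step A rec 1≤A with anyUpTo? (λ k → (2 ≤? k) ×-dec (k * k ∣? A)) (suc A)
    ... | no none = A , 1 , squareFree , sym (*-identityʳ A)
      where
      squareFree : SquareFree A
      squareFree zero 0∣A = contradiction (0∣⇒≡0 0∣A) (≢-sym (<⇒≢ 1≤A))
      squareFree (suc zero) _ = refl
      squareFree k@(suc (suc _)) kk∣A = contradiction
        (k , s≤s (≤-trans (m≤m*n k k) (∣⇒≤ {{ℕ.>-nonZero 1≤A}} kk∣A)) , s≤s (s≤s z≤n) , kk∣A) none
    ... | yes (k , _ , 2≤k , divides A′ A≡) with rec A′<A 1≤A′
      where
      1≤A′ : 1 ≤ A′
      1≤A′ = n≢0⇒n>0 (λ e → <⇒≢ 1≤A (sym (trans A≡ (cong (_* (k * k)) e))))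
      A′<A : A′ < A
      A′<A = subst (A′ <_) (sym A≡) (m<m*n A′ (k * k) {{ℕ.>-nonZero 1≤A′}}
                     (≤-trans 2≤k (m≤m*n k k {{ℕ.>-nonZero (≤-trans (s≤s z≤n) 2≤k)}})))
    ... | d , u , squareFree , A′≡ = d , u * k , squareFree , trans A≡ (trans (cong (_* (k * k)) A′≡) (solve (d ∷ u ∷ k ∷ [])))

  squareFree-cofactor : ∀ {d u w B} → SquareFree d → 1 ≤ u → u * u * B ≡ d * (w * w) → ∃[ v ] B ≡ d * (v * v)
  squareFree-cofactor {d} {u} {w} {B} sf 1≤u u²B≡dw² with divide-by-gcd u w 1≤u
  ... | g , u′ , w′ , 1≤g , u≡ , w≡ , coprime = w′ , trans (sym (trans (cong (λ z → z * z * B) u′≡1) (+-identityʳ B))) u′²B≡dw′²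
    where
    instance
      _ : NonZero (g * g)
      _ = ℕ.>-nonZero (*-mono-≤ 1≤g 1≤g)
    u′²B≡dw′² : u′ * u′ * B ≡ d * (w′ * w′)
    u′²B≡dw′² = *-cancelʳ-≡ _ _ (g * g) (begin
      (u′ * u′ * B) * (g * g)   ≡⟨ solve (u′ ∷ B ∷ g ∷ []) ⟩
      (u′ * g) * (u′ * g) * B   ≡⟨ cong (λ z → z * z * B) u≡ ⟨
      u * u * B                 ≡⟨ u²B≡dw² ⟩
      d * (w * w)               ≡⟨ cong (λ z → d * (z * z)) w≡ ⟩
      d * ((w′ * g) * (w′ * g)) ≡⟨ solve (d ∷ w′ ∷ g ∷ []) ⟩
      (d * (w′ * w′)) * (g * g) ∎)
      where open ≡-Reasoning
    u′≡1 : u′ ≡ 1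
    u′≡1 = sf u′ (coprime-divisor (coprime-squares coprime)
             (divides B (trans (*-comm (w′ * w′) d) (trans (sym u′²B≡dw′²) (*-comm (u′ * u′) B)))))

  squareFree-parts : ∀ A B w → 1 ≤ A → A * B ≡ w * w →
                     ∃[ d ] ∃[ u ] ∃[ v ] (SquareFree d × A ≡ d * (u * u) × B ≡ d * (v * v))
  squareFree-parts A B w 1≤A AB≡w² with squareFree-decomposition A 1≤A
  ... | d , u , sf , A≡ = cofactor (SquareFree⇒∣square⇒∣ sf (divides (u * u * B) w²≡))
    where
    instance
      _ : NonZero d
      _ = ℕ.≢-nonZero (SquareFree⇒≢0 sf)
    w²≡ : w * w ≡ (u * u * B) * d
    w²≡ = trans (sym AB≡w²) (trans (cong (_* B) A≡) (solve (d ∷ u ∷ B ∷ [])))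
    1≤u : 1 ≤ u
    1≤u = n≢0⇒n>0 (λ e → <⇒≢ 1≤A (sym (trans A≡ (trans (cong (λ z → d * (z * z)) e) (*-zeroʳ d)))))
    rearrange : ∀ w′ d → w′ * d * (w′ * d) ≡ d * (w′ * w′) * d
    rearrange = solve-∀
    cofactor : d ∣ w → ∃[ d ] ∃[ u ] ∃[ v ] (SquareFree d × A ≡ d * (u * u) × B ≡ d * (v * v))
    cofactor (divides w′ w≡) with squareFree-cofactor {w = w′} sf 1≤u
        (*-cancelʳ-≡ (u * u * B) (d * (w′ * w′)) d (trans (sym w²≡) (trans (cong (λ z → z * z) w≡) (rearrange w′ d))))
    ... | v , B≡ = d , u , v , sf , A≡ , B≡

module StarEquation where

  open import Data.Nat as ℕ using (ℕ; zero; suc; z≤n; s≤s)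
  import Data.Nat.Properties as ℕ
  open import Data.Nat.Divisibility as ℕ using (_∣_; divides; >⇒∤)
  open import Data.Nat.Tactic.RingSolver as ℕ-Solver using ()
  open import Data.Integer using (ℤ; +_; -_; _+_; _-_; _*_; _^_; 0ℤ; 1ℤ; -1ℤ; ∣_∣; -[1+_])
  open import Data.Integer.Properties
  open import Data.Integer.Tactic.RingSolver using (solve-∀)
  open import Data.Product using (_×_; _,_; ∃-syntax; proj₁; proj₂)
  open import Data.Sum using (_⊎_; inj₁; inj₂; [_,_]′)
  open import Function using (_∘_)
  open import Function.Bundles using (Equivalence)
  open import Relation.Binary.PropositionalEquality
  open import Relation.Binary.Definitions using (Tri; tri<; tri≈; tri>)
  open import Relation.Nullary using (¬_; contradiction)
  open import Defs
  open PellEquation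
  open SquareFreeParts

  bisector : ℤ → ℤ → ℤ → ℤ
  bisector a b c = (a + b) * (1ℤ - c * c) + + 2 * c * (a * b - 1ℤ)

  private
    Star-difference : ∀ a b c →
      (a - c) * (a - c) * (b * b + 1ℤ) - (b - c) * (b - c) * (a * a + 1ℤ) ≡ (a - b) * ((a + b) * (1ℤ - c * c) + + 2 * c * (a * b - 1ℤ))
    Star-difference = solve-∀

    Star-negate : ∀ a b c → (- a - - c) * (- a - - c) * (- b * - b + 1ℤ) ≡ (a - c) * (a - c) * (b * b + 1ℤ)
    Star-negate = solve-∀

  bisector≡0⇒Star : ∀ a b c → bisector a b c ≡ 0ℤ → Star a b c
  bisector≡0⇒Star a b c F≡0 =
    i-j≡0⇒i≡j _ _ (trans (Star-difference a b c) (trans (cong ((a - b) *_) F≡0) (*-zeroʳ (a - b))))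

  Star⇒bisector≡0 : ∀ {a b c} → a ≢ b → Star a b c → bisector a b c ≡ 0ℤ
  Star⇒bisector≡0 {a} {b} {c} a≢b star with i*j≡0⇒i≡0∨j≡0 (a - b) (trans (sym (Star-difference a b c)) (i≡j⇒i-j≡0 star))
  ... | inj₁ a-b≡0 = contradiction (i-j≡0⇒i≡j a b a-b≡0) a≢b
  ... | inj₂ F≡0 = F≡0

  Star-neg : ∀ {a b c} → Star a b c → Star (- a) (- b) (- c)
  Star-neg {a} {b} {c} star = trans (Star-negate a b c) (trans star (sym (Star-negate b a c)))

  private
    bisector-homogeneous : ∀ a b c δ → δ * δ * ((a + b) * (1ℤ - c * c) + + 2 * c * (a * b - 1ℤ))
                           ≡ (a + b) * (δ * δ - (c * δ) * (c * δ)) + + 2 * (c * δ) * δ * (a * b - 1ℤ)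
    bisector-homogeneous = solve-∀

    first-family-identity : ∀ D A B g δ →
      let β = A * δ + B * g ; α = A * g + D * B * δ ; b = α * g + D * β * δ in
      (A + b) * (δ * δ - β * β) + + 2 * β * δ * (A * b - 1ℤ)
      ≡ (- (+ 2 * B * g * δ) + + 2 * B * g * δ * δ * δ * D - A * δ * δ + A * δ * δ * δ * δ * D + A * g * g * δ * δ)
          * (A * A - D * (B * B) + 1ℤ)
        + (- (+ 2 * B * B * B * g * δ * D) - A * B * B * δ * δ * D - A * B * B * g * g) * (g * g - D * (δ * δ) + 1ℤ)
    first-family-identity = solve-∀

    second-family-identity : ∀ A B →
      (A + - ((A + + 2 * B) + + 2 * (A + B))) * (1ℤ - (A + + 2 * B) * (A + + 2 * B))
        + + 2 * (A + + 2 * B) * (A * - ((A + + 2 * B) + + 2 * (A + B)) - 1ℤ)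
      ≡ (- (+ 8 * B) - + 4 * A) * (A * A - + 2 * (B * B) + 1ℤ)
    second-family-identity = solve-∀

    i≡-1⇒i+1≡0 : ∀ {i} → i ≡ -1ℤ → i + 1ℤ ≡ 0ℤ
    i≡-1⇒i+1≡0 refl = refl

  i*i*j≡0⇒j≡0 : ∀ {i j} → i ≢ 0ℤ → i * i * j ≡ 0ℤ → j ≡ 0ℤ
  i*i*j≡0⇒j≡0 {i} {j} i≢0 e with i*j≡0⇒i≡0∨j≡0 (i * i) e
  ... | inj₂ j≡0 = j≡0
  ... | inj₁ ii≡0 with i*j≡0⇒i≡0∨j≡0 i ii≡0
  ...   | inj₁ i≡0 = contradiction i≡0 i≢0
  ...   | inj₂ i≡0 = contradiction i≡0 i≢0

  first-family-bisector≡0 : ∀ {D A B g δ c} → A * A - D * (B * B) ≡ -1ℤ → g * g - D * (δ * δ) ≡ -1ℤ → δ ≢ 0ℤ →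
                 c * δ ≡ A * δ + B * g → bisector A ((A * g + D * B * δ) * g + D * (A * δ + B * g) * δ) c ≡ 0ℤ
  first-family-bisector≡0 {D} {A} {B} {g} {δ} {c} N[A,B] N[g,δ] δ≢0 cδ≡β = i*i*j≡0⇒j≡0 δ≢0 (begin
    δ * δ * bisector A b c
      ≡⟨ bisector-homogeneous A b c δ ⟩
    (A + b) * (δ * δ - (c * δ) * (c * δ)) + + 2 * (c * δ) * δ * (A * b - 1ℤ)
      ≡⟨ cong (λ z → (A + b) * (δ * δ - z * z) + + 2 * z * δ * (A * b - 1ℤ)) cδ≡β ⟩
    _ ≡⟨ first-family-identity D A B g δ ⟩
    _ ≡⟨ cong₂ (λ u v → Λ₁ * u + Λ₂ * v) (i≡-1⇒i+1≡0 N[A,B]) (i≡-1⇒i+1≡0 N[g,δ]) ⟩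
    Λ₁ * 0ℤ + Λ₂ * 0ℤ ≡⟨ cong₂ _+_ (*-zeroʳ Λ₁) (*-zeroʳ Λ₂) ⟩
    0ℤ ∎)
    where
    open ≡-Reasoning
    b Λ₁ Λ₂ : ℤ
    b = (A * g + D * B * δ) * g + D * (A * δ + B * g) * δ
    Λ₁ = - (+ 2 * B * g * δ) + + 2 * B * g * δ * δ * δ * D - A * δ * δ + A * δ * δ * δ * δ * D + A * g * g * δ * δ
    Λ₂ = - (+ 2 * B * B * B * g * δ * D) - A * B * B * δ * δ * D - A * B * B * g * g

  second-family-bisector≡0 : ∀ {A B} → A * A - + 2 * (B * B) ≡ -1ℤ → bisector A (- ((A + + 2 * B) + + 2 * (A + B))) (A + + 2 * B) ≡ 0ℤ
  second-family-bisector≡0 {A} {B} N[A,B] = trans (second-family-identity A B)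
    (trans (cong ((- (+ 8 * B) - + 4 * A) *_) (i≡-1⇒i+1≡0 N[A,B])) (*-zeroʳ (- (+ 8 * B) - + 4 * A)))

  +∣i∣*∣i∣≡i*i : ∀ i → + (∣ i ∣ ℕ.* ∣ i ∣) ≡ i * i
  +∣i∣*∣i∣≡i*i (+ n) = pos-* n n
  +∣i∣*∣i∣≡i*i -[1+ n ] = refl

  i*+m≡+n⇒m∣n : ∀ {i m n} → i * + m ≡ + n → m ℕ.∣ n
  i*+m≡+n⇒m∣n {i} {m} {n} e = divides ∣ i ∣ (trans (sym (cong ∣_∣ e)) (abs-* i (+ m)))

  i*+m≡-+n⇒m∣n : ∀ {i m n} → i * + m ≡ - + n → m ℕ.∣ n
  i*+m≡-+n⇒m∣n {i} {m} {n} e = divides ∣ i ∣ (trans (sym (trans (cong ∣_∣ e) (∣-i∣≡∣i∣ (+ n)))) (abs-* i (+ m)))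

  +n≢0 : ∀ {n} → 1 ℕ.≤ n → + n ≢ 0ℤ
  +n≢0 {suc n} _ ()

  i*j≡0⇒j≡0 : ∀ {i j} → i ≢ 0ℤ → i * j ≡ 0ℤ → j ≡ 0ℤ
  i*j≡0⇒j≡0 {i} i≢0 e with i*j≡0⇒i≡0∨j≡0 i e
  ... | inj₁ i≡0 = contradiction i≡0 i≢0
  ... | inj₂ j≡0 = j≡0

  module Witnesses {d : ℕ} (2≤d : 2 ℕ.≤ d) (F : Fundamental d) where

    open NthSolution 2≤d F

    FormA-intro : Admissible d → ∀ {a b c} m n → 1 ℕ.≤ m → 1 ℕ.≤ n →
      a ≡ + X ((2 ℕ.* m ℕ.∸ 1) ℕ.* (2 ℕ.* n ℕ.∸ 1)) → b ≡ + X ((2 ℕ.* m ℕ.∸ 1) ℕ.* (2 ℕ.* n ℕ.+ 1)) →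
      c * + Y (2 ℕ.* m ℕ.∸ 1) ≡ + Y ((2 ℕ.* m ℕ.∸ 1) ℕ.* (2 ℕ.* n)) → FormA a b c
    FormA-intro admissible m n 1≤m 1≤n a≡ b≡ c≡ = d , m , n , admissible , 1≤m , 1≤n , _ , _ , _ , _ , _ , _ , _ , _ ,
      NthSol-XY (1≤index (2*m∸1≥1 1≤m) (2*m∸1≥1 1≤n)) , NthSol-XY (1≤index (2*m∸1≥1 1≤m) (ℕ.m≤n+m 1 (2 ℕ.* n))) ,
      NthSol-XY (1≤index (2*m∸1≥1 1≤m) (ℕ.≤-trans 1≤n (ℕ.m≤n*m n 2))) , NthSol-XY (2*m∸1≥1 1≤m) ,
      inj₁ (a≡ , b≡ , c≡)
      where
      2*m∸1≥1 : ∀ {m} → 1 ℕ.≤ m → 1 ℕ.≤ 2 ℕ.* m ℕ.∸ 1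
      2*m∸1≥1 {suc m} _ = ℕ.≤-trans (s≤s z≤n) (ℕ.m≤n+m (1 ℕ.* suc m) m)
      1≤index : ∀ {i j} → 1 ℕ.≤ i → 1 ℕ.≤ j → 1 ℕ.≤ i ℕ.* j
      1≤index 1≤i 1≤j = ℕ.*-mono-≤ 1≤i 1≤j

    FormB-intro : d ≡ 2 → ∀ {a b c} n → 1 ℕ.≤ n →
      a ≡ + X (2 ℕ.* n ℕ.∸ 1) → b ≡ - + X (2 ℕ.* n ℕ.+ 1) → c ≡ + X (2 ℕ.* n) → FormB a b c
    FormB-intro d≡2 (suc n) _ a≡ b≡ c≡ = suc n , s≤s z≤n , _ , _ , _ , _ , _ , _ ,
      NthSol-XY₂ (ℕ.≤-trans (s≤s z≤n) (ℕ.m≤n+m (1 ℕ.* suc n) n)) , NthSol-XY₂ (ℕ.m≤n+m 1 (2 ℕ.* suc n)) , NthSol-XY₂ (s≤s z≤n) ,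
      inj₁ (a≡ , b≡ , c≡)
      where
      NthSol-XY₂ : ∀ {k} → 1 ℕ.≤ k → NthSol 2 k (X k) (Y k)
      NthSol-XY₂ {k} 1≤k = subst (λ d → NthSol d k (X k) (Y k)) d≡2 (NthSol-XY 1≤k)

  -‿flip : ∀ i {j} → - i ≡ j → i ≡ - j
  -‿flip i refl = sym (neg-involutive i)

  FormA-neg : ∀ {a b c} → FormA (- a) (- b) (- c) → FormA a b c
  FormA-neg {a} {b} {c} (d , m , n , adm , 1≤m , 1≤n , x₁ , y₁ , x₂ , y₂ , x₃ , y₃ , x₄ , y₄ , s₁ , s₂ , s₃ , s₄ , signs) =
    d , m , n , adm , 1≤m , 1≤n , x₁ , y₁ , x₂ , y₂ , x₃ , y₃ , x₄ , y₄ , s₁ , s₂ , s₃ , s₄ , flip signs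
    where
    flip : (- a ≡ + x₁ × - b ≡ + x₂ × - c * + y₄ ≡ + y₃) ⊎ (- a ≡ - + x₁ × - b ≡ - + x₂ × - - c * + y₄ ≡ + y₃) →
           (a ≡ + x₁ × b ≡ + x₂ × c * + y₄ ≡ + y₃) ⊎ (a ≡ - + x₁ × b ≡ - + x₂ × - c * + y₄ ≡ + y₃)
    flip (inj₁ (a≡ , b≡ , c≡)) = inj₂ (-‿flip a a≡ , -‿flip b b≡ , c≡)
    flip (inj₂ (a≡ , b≡ , c≡)) = inj₁ (neg-injective a≡ , neg-injective b≡ , trans (cong (_* + y₄) (sym (neg-involutive c))) c≡)

  FormB-neg : ∀ {a b c} → FormB (- a) (- b) (- c) → FormB a b c
  FormB-neg {a} {b} {c} (n , 1≤n , x₁ , y₁ , x₂ , y₂ , x₃ , y₃ , s₁ , s₂ , s₃ , signs) =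
    n , 1≤n , x₁ , y₁ , x₂ , y₂ , x₃ , y₃ , s₁ , s₂ , s₃ , flip signs
    where
    flip : (- a ≡ + x₁ × - b ≡ - + x₂ × - c ≡ + x₃) ⊎ (- a ≡ - + x₁ × - b ≡ + x₂ × - c ≡ - + x₃) →
           (a ≡ + x₁ × b ≡ - + x₂ × c ≡ + x₃) ⊎ (a ≡ - + x₁ × b ≡ + x₂ × c ≡ - + x₃)
    flip (inj₁ (a≡ , b≡ , c≡)) = inj₂ (-‿flip a a≡ , neg-injective b≡ , -‿flip c c≡)
    flip (inj₂ (a≡ , b≡ , c≡)) = inj₁ (neg-injective a≡ , -‿flip b b≡ , neg-injective c≡)

  odd<odd⇒≡+2t : ∀ {P Q} → -1ℤ ^ P ≡ -1ℤ → -1ℤ ^ Q ≡ -1ℤ → P ℕ.< Q → ∃[ t ] (1 ℕ.≤ t × Q ≡ P ℕ.+ t ℕ.+ t)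
  odd<odd⇒≡+2t {P} {Q} P-odd Q-odd P<Q with -1^k≡-1⇒odd P P-odd | -1^k≡-1⇒odd Q Q-odd
  ... | i , refl | j , refl =
    j ℕ.∸ i , ℕ.m<n⇒0<n∸m i<j , trans (cong (λ k → suc (k ℕ.+ k)) (sym (ℕ.m+[n∸m]≡n (ℕ.<⇒≤ i<j)))) (rearrange i (j ℕ.∸ i))
    where
    i<j : i ℕ.< j
    i<j = ℕ.≰⇒> λ j≤i → ℕ.<⇒≱ P<Q (s≤s (ℕ.+-mono-≤ j≤i j≤i))
    rearrange : ∀ i t → suc (i ℕ.+ t ℕ.+ (i ℕ.+ t)) ≡ suc (i ℕ.+ i) ℕ.+ t ℕ.+ t
    rearrange = ℕ-Solver.solve-∀

  W : ℤ → ℤ → ℤ → ℤ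
  W a b c = (a + b) * c - (a * b - 1ℤ)

  W-defining : ∀ a b c → (a + b) * c - (a * b - 1ℤ + ((a + b) * c - (a * b - 1ℤ))) ≡ 0ℤ
  W-defining = solve-∀

  Star⇒W*W≡ : ∀ {a b c} → a ≢ b → Star a b c → W a b c * W a b c ≡ (a * a + 1ℤ) * (b * b + 1ℤ)
  Star⇒W*W≡ {a} {b} {c} a≢b star = begin
    W a b c * W a b c
      ≡⟨ W*W≡ a b c ⟩
    (a * a + 1ℤ) * (b * b + 1ℤ) - (a + b) * bisector a b c
      ≡⟨ cong (λ z → (a * a + 1ℤ) * (b * b + 1ℤ) - (a + b) * z) (Star⇒bisector≡0 a≢b star) ⟩
    (a * a + 1ℤ) * (b * b + 1ℤ) - (a + b) * 0ℤ
      ≡⟨ i-0 ((a * a + 1ℤ) * (b * b + 1ℤ)) (a + b) ⟩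
    (a * a + 1ℤ) * (b * b + 1ℤ) ∎
    where
    open ≡-Reasoning
    W*W≡ : ∀ a b c → ((a + b) * c - (a * b - 1ℤ)) * ((a + b) * c - (a * b - 1ℤ))
           ≡ (a * a + 1ℤ) * (b * b + 1ℤ) - (a + b) * ((a + b) * (1ℤ - c * c) + + 2 * c * (a * b - 1ℤ))
    W*W≡ = solve-∀
    i-0 : ∀ i j → i - j * 0ℤ ≡ i
    i-0 = solve-∀

  linear-relation : ∀ {L K N M} λ₁ λ₂ → L ≡ K + λ₁ * N + λ₂ * M → L ≡ 0ℤ → N ≡ 0ℤ → M ≡ 0ℤ → K ≡ 0ℤ
  linear-relation {L} {K} λ₁ λ₂ L≡ L≡0 refl refl = begin
    K                        ≡⟨ drop-zeros K λ₁ λ₂ ⟨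
    K + λ₁ * 0ℤ + λ₂ * 0ℤ  ≡⟨ L≡ ⟨
    L                        ≡⟨ L≡0 ⟩
    0ℤ                       ∎
    where
    open ≡-Reasoning
    drop-zeros : ∀ k l₁ l₂ → k + l₁ * 0ℤ + l₂ * 0ℤ ≡ k
    drop-zeros = solve-∀

  -- Here A + B √d = ε^P, g + δ √d = ε^t, α + β √d = ε^S and XQ + YQ √d = ε^Q. For each sign of
  -- b = ±XQ and of W = ±D B YQ and each parity of t (N and M ∓ 1 vanish), the defining equation
  -- of W is a multiple of a linear form in c.
  private
    case-b⁺-odd-W⁺ : ∀ A B g δ D c →
      let α = A * g + D * B * δ ; β = A * δ + B * g ; XQ = α * g + D * β * δ ; YQ = α * δ + β * g
          N = A * A - D * (B * B) + 1ℤ ; M = g * g - D * (δ * δ) in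
      (A + XQ) * c - (A * XQ - 1ℤ + D * B * YQ)
      ≡ + 2 * D * β * (δ * c - β) + (δ * δ * D - g * g) * N + (1ℤ + A * c) * (M + 1ℤ)
    case-b⁺-odd-W⁺ = solve-∀

    case-b⁺-odd-W⁻ : ∀ A B g δ D c →
      let α = A * g + D * B * δ ; β = A * δ + B * g ; XQ = α * g + D * β * δ ; YQ = α * δ + β * g
          N = A * A - D * (B * B) + 1ℤ ; M = g * g - D * (δ * δ) in
      (A + XQ) * c - (A * XQ - 1ℤ + - (D * B * YQ))
      ≡ + 2 * D * δ * (β * c + δ) + (- (δ * δ * D) - g * g) * N + (1ℤ + A * c) * (M + 1ℤ)
    case-b⁺-odd-W⁻ = solve-∀

    case-b⁺-even-W⁺ : ∀ A B g δ D c →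
      let α = A * g + D * B * δ ; β = A * δ + B * g ; XQ = α * g + D * β * δ ; YQ = α * δ + β * g
          N = A * A - D * (B * B) + 1ℤ ; M = g * g - D * (δ * δ) in
      (A + XQ) * c - (A * XQ - 1ℤ + D * B * YQ)
      ≡ + 2 * α * (g * c - α) + (- (δ * δ * D) + g * g) * N + (- (1ℤ + A * c)) * (M - 1ℤ)
    case-b⁺-even-W⁺ = solve-∀

    case-b⁺-even-W⁻ : ∀ A B g δ D c →
      let α = A * g + D * B * δ ; β = A * δ + B * g ; XQ = α * g + D * β * δ ; YQ = α * δ + β * g
          N = A * A - D * (B * B) + 1ℤ ; M = g * g - D * (δ * δ) in
      (A + XQ) * c - (A * XQ - 1ℤ + - (D * B * YQ))
      ≡ + 2 * g * (α * c + g) + (- (δ * δ * D) - g * g) * N + (- (1ℤ + A * c)) * (M - 1ℤ)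
    case-b⁺-even-W⁻ = solve-∀

    case-b⁻-odd-W⁺ : ∀ A B g δ D c →
      let α = A * g + D * B * δ ; β = A * δ + B * g ; XQ = α * g + D * β * δ ; YQ = α * δ + β * g
          N = A * A - D * (B * B) + 1ℤ ; M = g * g - D * (δ * δ) in
      (A + - XQ) * c - (A * - XQ - 1ℤ + D * B * YQ)
      ≡ - + 2 * g * (α * c + g) + (δ * δ * D + g * g) * N + (1ℤ + A * c) * (M + 1ℤ)
    case-b⁻-odd-W⁺ = solve-∀

    case-b⁻-odd-W⁻ : ∀ A B g δ D c →
      let α = A * g + D * B * δ ; β = A * δ + B * g ; XQ = α * g + D * β * δ ; YQ = α * δ + β * g
          N = A * A - D * (B * B) + 1ℤ ; M = g * g - D * (δ * δ) in
      (A + - XQ) * c - (A * - XQ - 1ℤ + - (D * B * YQ))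
      ≡ - + 2 * α * (g * c - α) + (δ * δ * D - g * g) * N + (1ℤ + A * c) * (M + 1ℤ)
    case-b⁻-odd-W⁻ = solve-∀

    case-b⁻-even-W⁺ : ∀ A B g δ D c →
      let α = A * g + D * B * δ ; β = A * δ + B * g ; XQ = α * g + D * β * δ ; YQ = α * δ + β * g
          N = A * A - D * (B * B) + 1ℤ ; M = g * g - D * (δ * δ) in
      (A + - XQ) * c - (A * - XQ - 1ℤ + D * B * YQ)
      ≡ - + 2 * D * δ * (β * c + δ) + (δ * δ * D + g * g) * N + (- (1ℤ + A * c)) * (M - 1ℤ)
    case-b⁻-even-W⁺ = solve-∀

    case-b⁻-even-W⁻ : ∀ A B g δ D c →
      let α = A * g + D * B * δ ; β = A * δ + B * g ; XQ = α * g + D * β * δ ; YQ = α * δ + β * g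
          N = A * A - D * (B * B) + 1ℤ ; M = g * g - D * (δ * δ) in
      (A + - XQ) * c - (A * - XQ - 1ℤ + - (D * B * YQ))
      ≡ - + 2 * D * β * (δ * c - β) + (- (δ * δ * D) + g * g) * N + (- (1ℤ + A * c)) * (M - 1ℤ)
    case-b⁻-even-W⁻ = solve-∀


  2[1+m]∸1≡1+2m : ∀ m → 2 ℕ.* suc m ℕ.∸ 1 ≡ suc (m ℕ.+ m)
  2[1+m]∸1≡1+2m m = cong (ℕ._∸ 1) (lemma m)
    where
    lemma : ∀ m → 2 ℕ.* suc m ≡ suc (suc (m ℕ.+ m))
    lemma = ℕ-Solver.solve-∀

  first-family-indices : ∀ {P t} m n → t ≡ suc (m ℕ.+ m) → P ℕ.+ t ≡ (suc n ℕ.+ suc n) ℕ.* t →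
    (2 ℕ.* suc m ℕ.∸ 1) ℕ.* (2 ℕ.* suc n ℕ.∸ 1) ≡ P ×
    (2 ℕ.* suc m ℕ.∸ 1) ℕ.* (2 ℕ.* suc n ℕ.+ 1) ≡ P ℕ.+ t ℕ.+ t ×
    (2 ℕ.* suc m ℕ.∸ 1) ℕ.* (2 ℕ.* suc n) ≡ P ℕ.+ t
  first-family-indices {P} m n refl S≡ =
    trans (cong₂ ℕ._*_ (2[1+m]∸1≡1+2m m) (2[1+m]∸1≡1+2m n)) (ℕ.+-cancelʳ-≡ t _ _ (trans (lemma₁ m n) (sym S≡))) ,
    trans (cong (ℕ._* (2 ℕ.* suc n ℕ.+ 1)) (2[1+m]∸1≡1+2m m)) (trans (lemma₂ m n) (cong (ℕ._+ t) (sym S≡))) ,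
    trans (cong (ℕ._* (2 ℕ.* suc n)) (2[1+m]∸1≡1+2m m)) (trans (lemma₃ m n) (sym S≡))
    where
    t : ℕ
    t = suc (m ℕ.+ m)
    lemma₁ : ∀ m n → suc (m ℕ.+ m) ℕ.* suc (n ℕ.+ n) ℕ.+ suc (m ℕ.+ m) ≡ (suc n ℕ.+ suc n) ℕ.* suc (m ℕ.+ m)
    lemma₁ = ℕ-Solver.solve-∀
    lemma₂ : ∀ m n → suc (m ℕ.+ m) ℕ.* (2 ℕ.* suc n ℕ.+ 1) ≡ (suc n ℕ.+ suc n) ℕ.* suc (m ℕ.+ m) ℕ.+ suc (m ℕ.+ m)
    lemma₂ = ℕ-Solver.solve-∀
    lemma₃ : ∀ m n → suc (m ℕ.+ m) ℕ.* (2 ℕ.* suc n) ≡ (suc n ℕ.+ suc n) ℕ.* suc (m ℕ.+ m)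
    lemma₃ = ℕ-Solver.solve-∀

  second-family-indices : ∀ i → 2 ℕ.* suc i ℕ.∸ 1 ≡ suc (i ℕ.+ i) × 2 ℕ.* suc i ≡ suc (i ℕ.+ i) ℕ.+ 1 ×
                                2 ℕ.* suc i ℕ.+ 1 ≡ suc (i ℕ.+ i) ℕ.+ 1 ℕ.+ 1
  second-family-indices i = 2[1+m]∸1≡1+2m i , lemma₁ i , cong (ℕ._+ 1) (lemma₁ i)
    where
    lemma₁ : ∀ i → 2 ℕ.* suc i ≡ suc (i ℕ.+ i) ℕ.+ 1
    lemma₁ = ℕ-Solver.solve-∀

  *-≢0 : ∀ {i j} → i ≢ 0ℤ → j ≢ 0ℤ → i * j ≢ 0ℤ
  *-≢0 {i} i≢0 j≢0 e with i*j≡0⇒i≡0∨j≡0 i e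
  ... | inj₁ i≡0 = i≢0 i≡0
  ... | inj₂ j≡0 = j≢0 j≡0

  2≢0 : + 2 ≢ 0ℤ
  2≢0 ()

  -2≢0 : - + 2 ≢ 0ℤ
  -2≢0 ()

  i+j≡0⇒i≡-j : ∀ {i j} → i + j ≡ 0ℤ → i ≡ - j
  i+j≡0⇒i≡-j {i} {j} e = i-j≡0⇒i≡j i (- j) (trans (cong (_+_ i) (neg-involutive j)) e)

  module Classification {d : ℕ} (admissible : Admissible d) (F : Fundamental d) where

    2≤d : 2 ℕ.≤ d
    2≤d = proj₁ (proj₂ admissible)

    open Fundamental F
    open NthSolution 2≤d F
    open Witnesses 2≤d F

    module _ {b c : ℤ} (P t : ℕ) (1≤P : 1 ℕ.≤ P) (1≤t : 1 ℕ.≤ t) (P-odd : -1ℤ ^ P ≡ -1ℤ)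
             (∣b∣≡ : ∣ b ∣ ≡ X (P ℕ.+ t ℕ.+ t))
             (∣W∣≡ : ∣ W (+ X P) b c ∣ ≡ d ℕ.* Y P ℕ.* Y (P ℕ.+ t ℕ.+ t)) where

      private
        S : ℕ
        S = P ℕ.+ t
        A B g δ D α β XQ YQ : ℤ
        A = + X P
        B = + Y P
        g = + X t
        δ = + Y t
        D = + d
        α = A * g + D * B * δ
        β = A * δ + B * g
        XQ = α * g + D * β * δ
        YQ = α * δ + β * g

      XS≡α : + X S ≡ α
      XS≡α = X-+ℤ P t

      YS≡β : + Y S ≡ β
      YS≡β = Y-+ℤ P t

      XQ≡ : + X (S ℕ.+ t) ≡ XQ
      XQ≡ = trans (X-+ℤ S t) (cong₂ (λ x y → x * g + D * y * δ) XS≡α YS≡β)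

      YQ≡ : + Y (S ℕ.+ t) ≡ YQ
      YQ≡ = trans (Y-+ℤ S t) (cong₂ (λ x y → x * δ + y * g) XS≡α YS≡β)

      N[A,B]+1≡0 : A * A - D * (B * B) + 1ℤ ≡ 0ℤ
      N[A,B]+1≡0 = cong (_+ 1ℤ) (trans (pellNorm-XY≡-1^k P) P-odd)

      N[g,δ]≡ : g * g - D * (δ * δ) ≡ -1ℤ ^ t
      N[g,δ]≡ = pellNorm-XY≡-1^k t

      b≡± : b ≡ XQ ⊎ b ≡ - XQ
      b≡± with +∣i∣≡i⊎+∣i∣≡-i b
      ... | inj₁ +∣b∣≡b = inj₁ (trans (sym +∣b∣≡b) (trans (cong +_ ∣b∣≡) XQ≡))
      ... | inj₂ +∣b∣≡-b = inj₂ (-‿flip b (trans (sym +∣b∣≡-b) (trans (cong +_ ∣b∣≡) XQ≡)))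

      private
        +∣W∣≡ : + ∣ W A b c ∣ ≡ D * B * YQ
        +∣W∣≡ = trans (cong +_ ∣W∣≡) (trans (+[a*b*c]≡ d (Y P) (Y (S ℕ.+ t))) (cong (D * B *_) YQ≡))

      W≡± : W A b c ≡ D * B * YQ ⊎ W A b c ≡ - (D * B * YQ)
      W≡± with +∣i∣≡i⊎+∣i∣≡-i (W A b c)
      ... | inj₁ +∣W∣≡W = inj₁ (trans (sym +∣W∣≡W) +∣W∣≡)
      ... | inj₂ +∣W∣≡-W = inj₂ (-‿flip (W A b c) (trans (sym +∣W∣≡-W) +∣W∣≡))


      master : ∀ {b′ w′} → b ≡ b′ → W A b c ≡ w′ → (A + b′) * c - (A * b′ - 1ℤ + w′) ≡ 0ℤ
      master refl refl = W-defining A b c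

      private
        t<S : t ℕ.< S
        t<S = subst (ℕ._< S) (ℕ.+-identityˡ t) (ℕ.+-monoˡ-< t 1≤P)

        1≤S : 1 ℕ.≤ S
        1≤S = ℕ.≤-trans 1≤t (ℕ.<⇒≤ t<S)

        S-parity : -1ℤ ^ S ≡ - (-1ℤ ^ t)
        S-parity = trans (^-distribˡ-+-* -1ℤ P t) (trans (cong (_* -1ℤ ^ t) P-odd) (-1*i≡-i (-1ℤ ^ t)))

      Y[S]∤Y[t] : ¬ (Y S ℕ.∣ Y t)
      Y[S]∤Y[t] = >⇒∤ {{ℕ.>-nonZero (1≤Y 1≤t)}} (Y-strictMono t<S)

      X[S]∤X[t] : ¬ (X S ℕ.∣ X t)
      X[S]∤X[t] = >⇒∤ {{ℕ.>-nonZero (1≤X t)}} (X-strictMono 1≤t t<S)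

      X[t]∣X[S]⇒X[t]≡1 : X t ℕ.∣ X S → X t ≡ 1
      X[t]∣X[S]⇒X[t]≡1 X[t]∣X[S] with ℕ.m≤n⇒m<n∨m≡n (1≤X t)
      ... | inj₂ 1≡Xt = sym 1≡Xt
      ... | inj₁ 1<Xt with X∣X⇒≡t-mod-2t {s = S} 1≤t 1<Xt X[t]∣X[S]
      ...   | k , S≡ = contradiction (trans (sym (trans (cong (-1ℤ ^_) S≡) (-1^[k*[t+t]+t]≡-1^t k t))) S-parity) (-1^k≢-[-1^k] t)

      Y[t]∣Y[S]⇒ : Y t ℕ.∣ Y S → -1ℤ ^ t ≡ -1ℤ × ∃[ n ] S ≡ (suc n ℕ.+ suc n) ℕ.* t
      Y[t]∣Y[S]⇒ Y[t]∣Y[S] with Y∣Y⇒∣ 1≤t Y[t]∣Y[S]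
      ... | divides k S≡kt with -1^k≡±1 t
      ...   | inj₁ t-even = contradiction (trans (sym (trans -1^S≡ (trans (cong (_^ k) t-even) (^-zeroˡ k))))
                                                 (trans S-parity (cong -_ t-even))) 1ℤ≢-1ℤ
        where
        -1^S≡ : -1ℤ ^ S ≡ (-1ℤ ^ t) ^ k
        -1^S≡ = trans (cong (-1ℤ ^_) S≡kt) (-1^[k*t]≡[-1^t]^k k t)
      ...   | inj₂ t-odd with -1^k≡1⇒even k (trans (sym -1^S≡) (trans S-parity (cong -_ t-odd)))
        where
        -1^S≡ : -1ℤ ^ S ≡ -1ℤ ^ k
        -1^S≡ = trans (cong (-1ℤ ^_) S≡kt) (trans (-1^[k*t]≡[-1^t]^k k t) (cong (_^ k) t-odd))
      ...     | zero , refl = contradiction S≡kt (ℕ.>⇒≢ 1≤S)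
      ...     | suc n , refl = t-odd , n , S≡kt

      first-family-case : c * δ ≡ + Y S → b ≡ + X (S ℕ.+ t) → FormA A b c
      first-family-case c*δ≡ b≡ with Y[t]∣Y[S]⇒ (i*+m≡+n⇒m∣n {c} {Y t} {Y S} c*δ≡)
      ... | t-odd , n , S≡ with -1^k≡-1⇒odd t t-odd
      ...   | m , t≡ with first-family-indices m n t≡ S≡
      ...     | P≡ , Q≡ , S≡′ = FormA-intro admissible {A} {b} {c} (suc m) (suc n) (s≤s z≤n) (s≤s z≤n)
        (cong (λ k → + X k) (sym P≡)) (trans b≡ (cong (λ k → + X k) (sym Q≡)))
        (subst₂ (λ i j → c * + Y i ≡ + Y j) (trans t≡ (sym (2[1+m]∸1≡1+2m m))) (sym S≡′) c*δ≡)

      second-family-case : X t ≡ 1 → c * g ≡ + X S → b ≡ - + X (S ℕ.+ t) → FormB A b c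
      second-family-case Xt≡1 c*g≡ b≡ with X≡1⇒≡1 1≤t Xt≡1 | -1^k≡-1⇒odd P P-odd
      ... | refl | i , refl with second-family-indices i
      ...   | P≡ , S≡ , Q≡ = FormB-intro d≡2 {A} {b} {c} (suc i) (s≤s z≤n)
        (cong (λ k → + X k) (sym P≡)) (trans b≡ (cong (λ k → - + X k) (sym Q≡)))
        (trans c≡ (cong (λ k → + X k) (sym S≡)))
        where
        p≡1 : p ≡ 1
        p≡1 = trans (sym X₁≡p) Xt≡1
        2≡dq² : 2 ≡ d ℕ.* (q ℕ.* q)
        2≡dq² = trans (cong (λ z → z ℕ.* z ℕ.+ 1) (sym p≡1)) negative
        d≡2 : d ≡ 2
        d≡2 = ℕ.≤-antisym
          (ℕ.≤-trans (ℕ.m≤m*n d (q ℕ.* q) {{ℕ.>-nonZero (ℕ.*-mono-≤ 1≤q 1≤q)}}) (ℕ.≤-reflexive (sym 2≡dq²))) 2≤d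
        c≡ : c ≡ + X S
        c≡ = trans (sym (*-identityʳ c)) (trans (cong (λ z → c * + z) (sym Xt≡1)) c*g≡)

      private
        D≢0 : D ≢ 0ℤ
        D≢0 = +n≢0 (ℕ.≤-trans (s≤s z≤n) 2≤d)
        g≢0 : g ≢ 0ℤ
        g≢0 = +n≢0 (1≤X t)
        δ≢0 : δ ≢ 0ℤ
        δ≢0 = +n≢0 (1≤Y 1≤t)
        α≢0 : α ≢ 0ℤ
        α≢0 α≡0 = +n≢0 (1≤X S) (trans XS≡α α≡0)
        β≢0 : β ≢ 0ℤ
        β≢0 β≡0 = +n≢0 (1≤Y 1≤S) (trans YS≡β β≡0)

        c*δ≡YS : ∀ {k} → k ≢ 0ℤ → k * (δ * c - β) ≡ 0ℤ → c * δ ≡ + Y S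
        c*δ≡YS k≢0 e = trans (*-comm c δ) (trans (i-j≡0⇒i≡j _ _ (i*j≡0⇒j≡0 k≢0 e)) (sym YS≡β))

        c*g≡XS : ∀ {k} → k ≢ 0ℤ → k * (g * c - α) ≡ 0ℤ → c * g ≡ + X S
        c*g≡XS k≢0 e = trans (*-comm c g) (trans (i-j≡0⇒i≡j _ _ (i*j≡0⇒j≡0 k≢0 e)) (sym XS≡α))

        k*[βc+δ]≢0 : ∀ {k} → k ≢ 0ℤ → k * (β * c + δ) ≢ 0ℤ
        k*[βc+δ]≢0 k≢0 e = Y[S]∤Y[t] (i*+m≡-+n⇒m∣n {c}
          (trans (*-comm c (+ Y S)) (trans (cong (_* c) YS≡β) (i+j≡0⇒i≡-j (i*j≡0⇒j≡0 k≢0 e)))))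

        k*[αc+g]≢0 : ∀ {k} → k ≢ 0ℤ → k * (α * c + g) ≢ 0ℤ
        k*[αc+g]≢0 k≢0 e = X[S]∤X[t] (i*+m≡-+n⇒m∣n {c}
          (trans (*-comm c (+ X S)) (trans (cong (_* c) XS≡α) (i+j≡0⇒i≡-j (i*j≡0⇒j≡0 k≢0 e)))))

        t-even⇒X[t]∤X[S] : -1ℤ ^ t ≡ 1ℤ → ¬ (X t ℕ.∣ X S)
        t-even⇒X[t]∤X[S] t-even X[t]∣X[S] with X≡1⇒≡1 1≤t (X[t]∣X[S]⇒X[t]≡1 X[t]∣X[S])
        ... | refl = 1ℤ≢-1ℤ (sym t-even)

        t-even⇒Y[t]∤Y[S] : -1ℤ ^ t ≡ 1ℤ → ¬ (Y t ℕ.∣ Y S)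
        t-even⇒Y[t]∤Y[S] t-even Y[t]∣Y[S] = 1ℤ≢-1ℤ (trans (sym t-even) (proj₁ (Y[t]∣Y[S]⇒ Y[t]∣Y[S])))

        λ₊₊ λ₊₋ λ₋₊ λ₋₋ μ : ℤ
        λ₊₊ = δ * δ * D + g * g
        λ₊₋ = δ * δ * D - g * g
        λ₋₊ = - (δ * δ * D) + g * g
        λ₋₋ = - (δ * δ * D) - g * g
        μ = 1ℤ + A * c

        M+1≡0 : -1ℤ ^ t ≡ -1ℤ → g * g - D * (δ * δ) + 1ℤ ≡ 0ℤ
        M+1≡0 t-odd = cong (_+ 1ℤ) (trans N[g,δ]≡ t-odd)

        M-1≡0 : -1ℤ ^ t ≡ 1ℤ → g * g - D * (δ * δ) - 1ℤ ≡ 0ℤ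
        M-1≡0 t-even = i≡j⇒i-j≡0 (trans N[g,δ]≡ t-even)

      -- Two cases give the families; the other six force Y S ∣ Y t or X S ∣ X t, or contradict
      -- the parity of t.
      classify : FormA A b c ⊎ FormB A b c
      classify = by-cases b≡± W≡± (-1^k≡±1 t)
        where
        by-cases : b ≡ XQ ⊎ b ≡ - XQ → W A b c ≡ D * B * YQ ⊎ W A b c ≡ - (D * B * YQ) → -1ℤ ^ t ≡ 1ℤ ⊎ -1ℤ ^ t ≡ -1ℤ →
                   FormA A b c ⊎ FormB A b c
        by-cases (inj₁ b≡) (inj₁ W≡) (inj₂ t-odd) = inj₁ (first-family-case
          (c*δ≡YS (*-≢0 (*-≢0 2≢0 D≢0) β≢0)
            (linear-relation λ₊₋ μ (case-b⁺-odd-W⁺ A B g δ D c) (master b≡ W≡) N[A,B]+1≡0 (M+1≡0 t-odd)))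
          (trans b≡ (sym XQ≡)))
        by-cases (inj₁ b≡) (inj₂ W≡) (inj₂ t-odd) = contradiction
          (linear-relation λ₋₋ μ (case-b⁺-odd-W⁻ A B g δ D c) (master b≡ W≡) N[A,B]+1≡0 (M+1≡0 t-odd))
          (k*[βc+δ]≢0 (*-≢0 (*-≢0 2≢0 D≢0) δ≢0))
        by-cases (inj₁ b≡) (inj₁ W≡) (inj₁ t-even) = contradiction
          (i*+m≡+n⇒m∣n {c} (c*g≡XS (*-≢0 2≢0 α≢0)
            (linear-relation λ₋₊ (- μ) (case-b⁺-even-W⁺ A B g δ D c) (master b≡ W≡) N[A,B]+1≡0 (M-1≡0 t-even))))
          (t-even⇒X[t]∤X[S] t-even)
        by-cases (inj₁ b≡) (inj₂ W≡) (inj₁ t-even) = contradiction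
          (linear-relation λ₋₋ (- μ) (case-b⁺-even-W⁻ A B g δ D c) (master b≡ W≡) N[A,B]+1≡0 (M-1≡0 t-even))
          (k*[αc+g]≢0 (*-≢0 2≢0 g≢0))
        by-cases (inj₂ b≡) (inj₁ W≡) (inj₂ t-odd) = contradiction
          (linear-relation λ₊₊ μ (case-b⁻-odd-W⁺ A B g δ D c) (master b≡ W≡) N[A,B]+1≡0 (M+1≡0 t-odd))
          (k*[αc+g]≢0 (*-≢0 -2≢0 g≢0))
        by-cases (inj₂ b≡) (inj₂ W≡) (inj₂ t-odd) =
          inj₂ (second-family-case (X[t]∣X[S]⇒X[t]≡1 (i*+m≡+n⇒m∣n {c} c*g≡)) c*g≡ (trans b≡ (cong -_ (sym XQ≡))))
          where
          c*g≡ : c * g ≡ + X S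
          c*g≡ = c*g≡XS (*-≢0 -2≢0 α≢0)
            (linear-relation λ₊₋ μ (case-b⁻-odd-W⁻ A B g δ D c) (master b≡ W≡) N[A,B]+1≡0 (M+1≡0 t-odd))
        by-cases (inj₂ b≡) (inj₁ W≡) (inj₁ t-even) = contradiction
          (linear-relation λ₊₊ (- μ) (case-b⁻-even-W⁺ A B g δ D c) (master b≡ W≡) N[A,B]+1≡0 (M-1≡0 t-even))
          (k*[βc+δ]≢0 (*-≢0 (*-≢0 -2≢0 D≢0) δ≢0))
        by-cases (inj₂ b≡) (inj₂ W≡) (inj₁ t-even) = contradiction
          (i*+m≡+n⇒m∣n {c} (c*δ≡YS (*-≢0 (*-≢0 -2≢0 D≢0) β≢0)
            (linear-relation λ₋₊ (- μ) (case-b⁻-even-W⁻ A B g δ D c) (master b≡ W≡) N[A,B]+1≡0 (M-1≡0 t-even))))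
          (t-even⇒Y[t]∤Y[S] t-even)

  Star⇒square-product : ∀ {aN b c} → aN ℕ.< ∣ b ∣ → Star (+ aN) b c →
    (aN ℕ.* aN ℕ.+ 1) ℕ.* (∣ b ∣ ℕ.* ∣ b ∣ ℕ.+ 1) ≡ ∣ W (+ aN) b c ∣ ℕ.* ∣ W (+ aN) b c ∣
  Star⇒square-product {aN} {b} {c} aN<∣b∣ star = +-injective (begin
    + ((aN ℕ.* aN ℕ.+ 1) ℕ.* (∣ b ∣ ℕ.* ∣ b ∣ ℕ.+ 1))   ≡⟨ pos-* (aN ℕ.* aN ℕ.+ 1) (∣ b ∣ ℕ.* ∣ b ∣ ℕ.+ 1) ⟩
    + (aN ℕ.* aN ℕ.+ 1) * + (∣ b ∣ ℕ.* ∣ b ∣ ℕ.+ 1)      ≡⟨ cong₂ _*_ (+[n*n+1]≡ (+ aN)) (+[n*n+1]≡ b) ⟩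
    (+ aN * + aN + 1ℤ) * (b * b + 1ℤ)                    ≡⟨ Star⇒W*W≡ +aN≢b star ⟨
    W (+ aN) b c * W (+ aN) b c                          ≡⟨ +∣i∣*∣i∣≡i*i (W (+ aN) b c) ⟨
    + (∣ W (+ aN) b c ∣ ℕ.* ∣ W (+ aN) b c ∣)           ∎)
    where
    open ≡-Reasoning
    +aN≢b : + aN ≢ b
    +aN≢b e = ℕ.<-irrefl (cong ∣_∣ e) aN<∣b∣
    +[n*n+1]≡ : ∀ i → + (∣ i ∣ ℕ.* ∣ i ∣ ℕ.+ 1) ≡ i * i + 1ℤ
    +[n*n+1]≡ i = trans (pos-+ (∣ i ∣ ℕ.* ∣ i ∣) 1) (cong (_+ 1ℤ) (+∣i∣*∣i∣≡i*i i))

  common-squareFree-part≥2 : ∀ {aN b d u v} → aN ℕ.< ∣ b ∣ → SquareFree d → PellNeg d aN u → PellNeg d ∣ b ∣ v → 2 ℕ.≤ d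
  common-squareFree-part≥2 {aN} {b} {d} {u} {v} aN<∣b∣ squareFree a-neg b-neg = n≢0∧n≢1⇒2≤n (SquareFree⇒≢0 squareFree) d≢1
    where
    n≢0∧n≢1⇒2≤n : ∀ {n} → n ≢ 0 → n ≢ 1 → 2 ℕ.≤ n
    n≢0∧n≢1⇒2≤n {zero} n≢0 _ = contradiction refl n≢0
    n≢0∧n≢1⇒2≤n {suc zero} _ n≢1 = contradiction refl n≢1
    n≢0∧n≢1⇒2≤n {suc (suc _)} _ _ = s≤s (s≤s z≤n)
    d≢1 : d ≢ 1
    d≢1 refl = ℕ.<⇒≢ aN<∣b∣ (trans (n*n+1≡m*m⇒n≡0 aN u (trans a-neg (ℕ.*-identityˡ _)))
                                    (sym (n*n+1≡m*m⇒n≡0 ∣ b ∣ v (trans b-neg (ℕ.*-identityˡ _)))))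

  module _ {aN : ℕ} {b c : ℤ} (aN<∣b∣ : aN ℕ.< ∣ b ∣) (star : Star (+ aN) b c)
           {d u v : ℕ} (squareFree : SquareFree d) (a-neg : PellNeg d aN u) (b-neg : PellNeg d ∣ b ∣ v)
           (2≤d : 2 ℕ.≤ d) (F : Fundamental d) where

    open NthSolution 2≤d F

    private
      admissible : Admissible d
      admissible = squareFree , 2≤d , + aN , + u , Equivalence.to (pellNeg⇔ d aN u) a-neg

      index-of : ∀ {x y} → PellNeg d x y → ∃[ k ] (1 ℕ.≤ k × x ≡ X k × y ≡ Y k × -1ℤ ^ k ≡ -1ℤ)
      index-of {x} {y} neg with IsSol⇒XY (PositiveSol⇒IsSol (PellNeg⇒1≤x {d} {x} {y} 2≤d neg , PellNeg⇒1≤y {d} {x} {y} neg , inj₂ neg))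
      ... | k , 1≤k , refl , refl = k , 1≤k , refl , refl , trans (sym (pellNorm-XY≡-1^k k)) (Equivalence.to (pellNeg⇔ d (X k) (Y k)) neg)

    classify-in-d : FormA (+ aN) b c ⊎ FormB (+ aN) b c
    classify-in-d with index-of {aN} {u} a-neg | index-of {∣ b ∣} {v} b-neg
    ... | P , 1≤P , aN≡ , u≡ , P-odd | Q , 1≤Q , ∣b∣≡ , v≡ , Q-odd
      with odd<odd⇒≡+2t P-odd Q-odd (X-cancel-< 1≤P 1≤Q (subst₂ ℕ._<_ aN≡ ∣b∣≡ aN<∣b∣))
    ... | t , 1≤t , refl = subst (λ a → FormA a b c ⊎ FormB a b c) (cong +_ (sym aN≡))
        (Classification.classify admissible F {b} {c} P t 1≤P 1≤t P-odd ∣b∣≡ (subst (λ a → ∣ W (+ a) b c ∣ ≡ d ℕ.* Y P ℕ.* Y Q) aN≡ ∣W∣≡))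
      where
      ∣W∣≡ : ∣ W (+ aN) b c ∣ ≡ d ℕ.* Y P ℕ.* Y Q
      ∣W∣≡ = n*n-injective (begin
        ∣ W (+ aN) b c ∣ ℕ.* ∣ W (+ aN) b c ∣           ≡⟨ Star⇒square-product {aN} {b} {c} aN<∣b∣ star ⟨
        (aN ℕ.* aN ℕ.+ 1) ℕ.* (∣ b ∣ ℕ.* ∣ b ∣ ℕ.+ 1)  ≡⟨ cong₂ ℕ._*_ a-neg b-neg ⟩
        d ℕ.* (u ℕ.* u) ℕ.* (d ℕ.* (v ℕ.* v))          ≡⟨ rearrange d u v ⟩
        d ℕ.* u ℕ.* v ℕ.* (d ℕ.* u ℕ.* v)              ≡⟨ cong₂ (λ y z → d ℕ.* y ℕ.* z ℕ.* (d ℕ.* y ℕ.* z)) u≡ v≡ ⟩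
        d ℕ.* Y P ℕ.* Y Q ℕ.* (d ℕ.* Y P ℕ.* Y Q)      ∎)
        where
        open ≡-Reasoning
        rearrange : ∀ d u v → d ℕ.* (u ℕ.* u) ℕ.* (d ℕ.* (v ℕ.* v)) ≡ d ℕ.* u ℕ.* v ℕ.* (d ℕ.* u ℕ.* v)
        rearrange = ℕ-Solver.solve-∀

  classify-positive : ∀ aN b c → aN ℕ.< ∣ b ∣ → Star (+ aN) b c → FormA (+ aN) b c ⊎ FormB (+ aN) b c
  classify-positive aN b c aN<∣b∣ star =
    in-common-part (squareFree-parts (aN ℕ.* aN ℕ.+ 1) (∣ b ∣ ℕ.* ∣ b ∣ ℕ.+ 1) ∣ W (+ aN) b c ∣ (ℕ.m≤n+m 1 (aN ℕ.* aN))
                                     (Star⇒square-product {aN} {b} {c} aN<∣b∣ star))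
    where
    in-common-part : ∃[ d ] ∃[ u ] ∃[ v ] (SquareFree d × PellNeg d aN u × PellNeg d ∣ b ∣ v) → FormA (+ aN) b c ⊎ FormB (+ aN) b c
    in-common-part (d , u , v , squareFree , a-neg , b-neg) =
      classify-in-d {aN} {b} {c} aN<∣b∣ star {d} {u} {v} squareFree a-neg b-neg 2≤d (fundamental {d} {aN} {u} 2≤d a-neg)
      where
      2≤d : 2 ℕ.≤ d
      2≤d = common-squareFree-part≥2 {aN} {b} {d} {u} {v} aN<∣b∣ squareFree a-neg b-neg

  classify : ∀ a b c → ∣ a ∣ ℕ.< ∣ b ∣ → Star a b c → FormA a b c ⊎ FormB a b c
  classify a b c ∣a∣<∣b∣ star = by-sign (+∣i∣≡i⊎+∣i∣≡-i a)
    where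
    by-sign : + ∣ a ∣ ≡ a ⊎ + ∣ a ∣ ≡ - a → FormA a b c ⊎ FormB a b c
    by-sign (inj₁ +∣a∣≡a) = subst (λ a → FormA a b c ⊎ FormB a b c) +∣a∣≡a
      (classify-positive ∣ a ∣ b c ∣a∣<∣b∣ (subst (λ a → Star a b c) (sym +∣a∣≡a) star))
    by-sign (inj₂ +∣a∣≡-a) = [ (λ formA → inj₁ (FormA-neg {a} {b} {c} (subst (λ a → FormA a (- b) (- c)) +∣a∣≡-a formA)))
                             , (λ formB → inj₂ (FormB-neg {a} {b} {c} (subst (λ a → FormB a (- b) (- c)) +∣a∣≡-a formB))) ]′
      (classify-positive ∣ a ∣ (- b) (- c) (subst (∣ a ∣ ℕ.<_) (sym (∣-i∣≡∣i∣ b)) ∣a∣<∣b∣)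
                         (subst (λ a → Star a (- b) (- c)) (sym +∣a∣≡-a) (Star-neg {a} {b} {c} star)))

  nontrivial-solutions : (a b c : ℤ) → Star a b c → Nontrivial a b → (FormA a b c ⊎ FormA b a c) ⊎ (FormB a b c ⊎ FormB b a c)
  nontrivial-solutions a b c star nontrivial = by-size (ℕ.<-cmp ∣ a ∣ ∣ b ∣)
    where
    by-size : Tri (∣ a ∣ ℕ.< ∣ b ∣) (∣ a ∣ ≡ ∣ b ∣) (∣ b ∣ ℕ.< ∣ a ∣) → (FormA a b c ⊎ FormA b a c) ⊎ (FormB a b c ⊎ FormB b a c)
    by-size (tri≈ _ ∣a∣≡∣b∣ _) = contradiction ∣a∣≡∣b∣ nontrivial
    by-size (tri< ∣a∣<∣b∣ _ _) = [ inj₁ ∘ inj₁ , inj₂ ∘ inj₁ ]′ (classify a b c ∣a∣<∣b∣ star)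
    by-size (tri> _ _ ∣b∣<∣a∣) = [ inj₁ ∘ inj₂ , inj₂ ∘ inj₂ ]′ (classify b a c ∣b∣<∣a∣ (sym star))

  NegPellSolvable⇒Fundamental : ∀ {d} → 2 ℕ.≤ d → NegPellSolvable d → Fundamental d
  NegPellSolvable⇒Fundamental {d} 2≤d (x , y , N≡-1) =
    fundamental {d} {∣ x ∣} {∣ y ∣} 2≤d (Equivalence.from (pellNeg⇔ d ∣ x ∣ ∣ y ∣) (trans N≡ N≡-1))
    where
    +∣i∣*+∣i∣≡i*i : ∀ i → + ∣ i ∣ * + ∣ i ∣ ≡ i * i
    +∣i∣*+∣i∣≡i*i i = trans (sym (pos-* ∣ i ∣ ∣ i ∣)) (+∣i∣*∣i∣≡i*i i)
    N≡ : pellNorm d ∣ x ∣ ∣ y ∣ ≡ x * x - + d * (y * y)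
    N≡ = cong₂ (λ u v → u - + d * v) (+∣i∣*+∣i∣≡i*i x) (+∣i∣*+∣i∣≡i*i y)

  -1^[odd*odd]≡-1 : ∀ m n → -1ℤ ^ (suc (m ℕ.+ m) ℕ.* suc (n ℕ.+ n)) ≡ -1ℤ
  -1^[odd*odd]≡-1 m n = trans (cong (-1ℤ ^_) (ℕ.*-comm (suc (m ℕ.+ m)) (suc (n ℕ.+ n))))
    (trans (-1^[k*t]≡[-1^t]^k (suc (n ℕ.+ n)) (suc (m ℕ.+ m)))
    (trans (cong (_^ suc (n ℕ.+ n)) (-1^[1+i+i]≡-1 m)) (-1^[1+i+i]≡-1 n)))

  module _ {d : ℕ} (2≤d : 2 ℕ.≤ d) (solvable : NegPellSolvable d) where

    open NthSolution 2≤d (NegPellSolvable⇒Fundamental 2≤d solvable)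

    first-family-XY : ∀ m n →
      let T = 2 ℕ.* suc m ℕ.∸ 1 in
      Y T ∣ Y (T ℕ.* (2 ℕ.* suc n)) ×
      (∀ c → c * + Y T ≡ + Y (T ℕ.* (2 ℕ.* suc n)) → Star (+ X (T ℕ.* (2 ℕ.* suc n ℕ.∸ 1))) (+ X (T ℕ.* (2 ℕ.* suc n ℕ.+ 1))) c)
    first-family-XY m n = subst (λ k → Y T ∣ Y k) (ℕ.*-comm (2 ℕ.* suc n) T) (Y∣Y[k*t] (2 ℕ.* suc n) T) , star
      where
      T P₁ S₁ Q₁ : ℕ
      T = 2 ℕ.* suc m ℕ.∸ 1
      P₁ = T ℕ.* (2 ℕ.* suc n ℕ.∸ 1)
      S₁ = T ℕ.* (2 ℕ.* suc n)
      Q₁ = T ℕ.* (2 ℕ.* suc n ℕ.+ 1)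
      P₁+T≡S₁ : P₁ ℕ.+ T ≡ S₁
      P₁+T≡S₁ = trans (cong (λ k → T ℕ.* k ℕ.+ T) (2[1+m]∸1≡1+2m n)) (lemma T n)
        where
        lemma : ∀ t n → t ℕ.* suc (n ℕ.+ n) ℕ.+ t ≡ t ℕ.* (2 ℕ.* suc n)
        lemma = ℕ-Solver.solve-∀
      S₁+T≡Q₁ : S₁ ℕ.+ T ≡ Q₁
      S₁+T≡Q₁ = lemma T n
        where
        lemma : ∀ t n → t ℕ.* (2 ℕ.* suc n) ℕ.+ t ≡ t ℕ.* (2 ℕ.* suc n ℕ.+ 1)
        lemma = ℕ-Solver.solve-∀
      A B g δ D : ℤ
      A = + X P₁
      B = + Y P₁
      g = + X T
      δ = + Y T
      D = + d
      XS≡ : + X S₁ ≡ A * g + D * B * δ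
      XS≡ = trans (cong (λ k → + X k) (sym P₁+T≡S₁)) (X-+ℤ P₁ T)
      YS≡ : + Y S₁ ≡ A * δ + B * g
      YS≡ = trans (cong (λ k → + Y k) (sym P₁+T≡S₁)) (Y-+ℤ P₁ T)
      XQ≡ : + X Q₁ ≡ (A * g + D * B * δ) * g + D * (A * δ + B * g) * δ
      XQ≡ = trans (cong (λ k → + X k) (sym S₁+T≡Q₁)) (trans (X-+ℤ S₁ T) (cong₂ (λ x y → x * g + D * y * δ) XS≡ YS≡))
      T≡ : T ≡ suc (m ℕ.+ m)
      T≡ = 2[1+m]∸1≡1+2m m
      N[A,B] : A * A - D * (B * B) ≡ -1ℤ
      N[A,B] = trans (pellNorm-XY≡-1^k P₁) (subst (λ k → -1ℤ ^ k ≡ -1ℤ) (sym (cong₂ ℕ._*_ T≡ (2[1+m]∸1≡1+2m n))) (-1^[odd*odd]≡-1 m n))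
      N[g,δ] : g * g - D * (δ * δ) ≡ -1ℤ
      N[g,δ] = trans (pellNorm-XY≡-1^k T) (subst (λ k → -1ℤ ^ k ≡ -1ℤ) (sym T≡) (-1^[1+i+i]≡-1 m))
      star : ∀ c → c * δ ≡ + Y S₁ → Star A (+ X Q₁) c
      star c c*δ≡ = bisector≡0⇒Star A (+ X Q₁) c (subst (λ b → bisector A b c ≡ 0ℤ) (sym XQ≡)
        (first-family-bisector≡0 {D} {A} {B} {g} {δ} {c} N[A,B] N[g,δ] (+n≢0 (1≤Y (subst (1 ℕ.≤_) (sym T≡) (s≤s z≤n)))) (trans c*δ≡ YS≡)))

  first-family-solutions : (d m n : ℕ) → Admissible d → 1 ℕ.≤ m → 1 ℕ.≤ n →
    (x₁ y₁ x₂ y₂ x₃ y₃ x₄ y₄ : ℕ) →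
    NthSol d ((2 ℕ.* m ℕ.∸ 1) ℕ.* (2 ℕ.* n ℕ.∸ 1)) x₁ y₁ →
    NthSol d ((2 ℕ.* m ℕ.∸ 1) ℕ.* (2 ℕ.* n ℕ.+ 1)) x₂ y₂ →
    NthSol d ((2 ℕ.* m ℕ.∸ 1) ℕ.* (2 ℕ.* n)) x₃ y₃ →
    NthSol d (2 ℕ.* m ℕ.∸ 1) x₄ y₄ →
    y₄ ∣ y₃ × ((c : ℤ) → c * + y₄ ≡ + y₃ → Star (+ x₁) (+ x₂) c × Star (- + x₁) (- + x₂) (- c))
  first-family-solutions d (suc m) (suc n) (_ , 2≤d , solvable) _ _ x₁ y₁ x₂ y₂ x₃ y₃ x₄ y₄ s₁ s₂ s₃ s₄ =
    subst₂ _∣_ (sym (proj₂ (NthSol⇒XY s₄))) (sym (proj₂ (NthSol⇒XY s₃))) (proj₁ (first-family-XY 2≤d solvable m n)) ,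
    λ c c*y₄≡y₃ → with-negation (subst₂ (λ x x′ → Star (+ x) (+ x′) c) (sym (proj₁ (NthSol⇒XY s₁))) (sym (proj₁ (NthSol⇒XY s₂)))
      (proj₂ (first-family-XY 2≤d solvable m n) c (subst₂ (λ y y′ → c * + y ≡ + y′) (proj₂ (NthSol⇒XY s₄)) (proj₂ (NthSol⇒XY s₃)) c*y₄≡y₃)))
    where
    open NthSolution 2≤d (NegPellSolvable⇒Fundamental 2≤d solvable)
    with-negation : ∀ {c} → Star (+ x₁) (+ x₂) c → Star (+ x₁) (+ x₂) c × Star (- + x₁) (- + x₂) (- c)
    with-negation {c} star = star , Star-neg {+ x₁} {+ x₂} {c} star

  private
    fundamental₂ : Fundamental 2
    fundamental₂ = fundamental {2} {1} {1} (s≤s (s≤s z≤n)) refl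

    open Fundamental fundamental₂
    open NthSolution (s≤s (s≤s z≤n)) fundamental₂

    q≡1 : q ≡ 1
    q≡1 = ℕ.≤-antisym (minimal {1} {1} (s≤s z≤n , s≤s z≤n , inj₂ refl)) 1≤q

    p≡1 : p ≡ 1
    p≡1 = n*n-injective (ℕ.+-cancelʳ-≡ 1 (p ℕ.* p) 1 (trans negative (cong (λ z → 2 ℕ.* (z ℕ.* z)) q≡1)))

    X₁≡1 : + X 1 ≡ 1ℤ
    X₁≡1 = cong +_ (trans X₁≡p p≡1)

    Y₁≡1 : + Y 1 ≡ 1ℤ
    Y₁≡1 = cong +_ (trans Y₁≡q q≡1)

    step-by-1 : ∀ k → + X (k ℕ.+ 1) ≡ + X k + + 2 * + Y k × + Y (k ℕ.+ 1) ≡ + X k + + Y k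
    step-by-1 k = trans (X-+ℤ k 1) (trans (cong₂ (λ x y → + X k * x + + 2 * + Y k * y) X₁≡1 Y₁≡1) (lemma₁ (+ X k) (+ Y k))) ,
                  trans (Y-+ℤ k 1) (trans (cong₂ (λ x y → + X k * y + + Y k * x) X₁≡1 Y₁≡1) (lemma₂ (+ X k) (+ Y k)))
      where
      lemma₁ : ∀ a b → a * 1ℤ + + 2 * b * 1ℤ ≡ a + + 2 * b
      lemma₁ = solve-∀
      lemma₂ : ∀ a b → a * 1ℤ + b * 1ℤ ≡ a + b
      lemma₂ = solve-∀

    at-indices : ∀ {x y z x′ y′ z′} → x ≡ x′ → y ≡ y′ → z ≡ z′ → Star (+ x) (- + y) (+ z) → Star (+ x′) (- + y′) (+ z′)
    at-indices refl refl refl star = star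

    second-family-XY : ∀ n → Star (+ X (2 ℕ.* suc n ℕ.∸ 1)) (- + X (2 ℕ.* suc n ℕ.+ 1)) (+ X (2 ℕ.* suc n))
    second-family-XY n = at-indices (cong X (sym P≡)) (cong X (sym Q≡)) (cong X (sym S≡))
      (bisector≡0⇒Star (+ X P) (- + X (P ℕ.+ 1 ℕ.+ 1)) (+ X (P ℕ.+ 1))
        (subst₂ (λ b c → bisector (+ X P) b c ≡ 0ℤ) (sym (cong -_ XQ≡)) (sym XS≡) (second-family-bisector≡0 {+ X P} {+ Y P} N[A,B])))
      where
      P : ℕ
      P = suc (n ℕ.+ n)
      P≡ : 2 ℕ.* suc n ℕ.∸ 1 ≡ P
      P≡ = proj₁ (second-family-indices n)
      S≡ : 2 ℕ.* suc n ≡ P ℕ.+ 1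
      S≡ = proj₁ (proj₂ (second-family-indices n))
      Q≡ : 2 ℕ.* suc n ℕ.+ 1 ≡ P ℕ.+ 1 ℕ.+ 1
      Q≡ = proj₂ (proj₂ (second-family-indices n))
      XS≡ : + X (P ℕ.+ 1) ≡ + X P + + 2 * + Y P
      XS≡ = proj₁ (step-by-1 P)
      XQ≡ : + X (P ℕ.+ 1 ℕ.+ 1) ≡ (+ X P + + 2 * + Y P) + + 2 * (+ X P + + Y P)
      XQ≡ = trans (proj₁ (step-by-1 (P ℕ.+ 1))) (cong₂ (λ x y → x + + 2 * y) XS≡ (proj₂ (step-by-1 P)))
      N[A,B] : + X P * + X P - + 2 * (+ Y P * + Y P) ≡ -1ℤ
      N[A,B] = trans (pellNorm-XY≡-1^k P) (-1^[1+i+i]≡-1 n)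

  second-family-solutions : (n : ℕ) → 1 ℕ.≤ n → (x₁ y₁ x₂ y₂ x₃ y₃ : ℕ) →
    NthSol 2 (2 ℕ.* n ℕ.∸ 1) x₁ y₁ → NthSol 2 (2 ℕ.* n ℕ.+ 1) x₂ y₂ → NthSol 2 (2 ℕ.* n) x₃ y₃ →
    Star (+ x₁) (- + x₂) (+ x₃) × Star (- + x₁) (+ x₂) (- + x₃)
  second-family-solutions (suc n) _ x₁ y₁ x₂ y₂ x₃ y₃ s₁ s₂ s₃ =
    star , subst (λ b → Star (- + x₁) b (- + x₃)) (neg-involutive (+ x₂)) (Star-neg {a = + x₁} {b = - + x₂} {c = + x₃} star)
    where
    star : Star (+ x₁) (- + x₂) (+ x₃)
    star = at-indices (sym (proj₁ (NthSol⇒XY s₁))) (sym (proj₁ (NthSol⇒XY s₂))) (sym (proj₁ (NthSol⇒XY s₃))) (second-family-XY n)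

open StarEquation using (nontrivial-solutions; first-family-solutions; second-family-solutions)

open import Defs
open import Data.Nat as ℕ using (ℕ)
open import Data.Integer as ℤ using (ℤ; +_; _*_; -_)
open import Data.Product using (_×_; _,_)
open import Data.Sum using (_⊎_)
open import Data.Nat.Divisibility using (_∣_)
open import Relation.Binary.PropositionalEquality using (_≡_)

theorem1p6 :
    ((a b c : ℤ) → Star a b c → Nontrivial a b →
       (FormA a b c ⊎ FormA b a c) ⊎ (FormB a b c ⊎ FormB b a c))
    ×
    ((d m n : ℕ) → Admissible d → 1 ℕ.≤ m → 1 ℕ.≤ n →
       (x₁ y₁ x₂ y₂ x₃ y₃ x₄ y₄ : ℕ) →
       NthSol d ((2 ℕ.* m ℕ.∸ 1) ℕ.* (2 ℕ.* n ℕ.∸ 1)) x₁ y₁ →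
       NthSol d ((2 ℕ.* m ℕ.∸ 1) ℕ.* (2 ℕ.* n ℕ.+ 1)) x₂ y₂ →
       NthSol d ((2 ℕ.* m ℕ.∸ 1) ℕ.* (2 ℕ.* n)) x₃ y₃ →
       NthSol d (2 ℕ.* m ℕ.∸ 1) x₄ y₄ →
       y₄ ∣ y₃ ×
       ((c : ℤ) → c * + y₄ ≡ + y₃ →
          Star (+ x₁) (+ x₂) c × Star (- + x₁) (- + x₂) (- c)))
    ×
    ((n : ℕ) → 1 ℕ.≤ n → (x₁ y₁ x₂ y₂ x₃ y₃ : ℕ) →
       NthSol 2 (2 ℕ.* n ℕ.∸ 1) x₁ y₁ →
       NthSol 2 (2 ℕ.* n ℕ.+ 1) x₂ y₂ →
       NthSol 2 (2 ℕ.* n) x₃ y₃ →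
       Star (+ x₁) (- + x₂) (+ x₃) × Star (- + x₁) (+ x₂) (- + x₃))
theorem1p6 = nontrivial-solutions , first-family-solutions , second-family-solutions
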